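{- Let $(s,\gamma,w)$ be a weighted labelled chain. Then $$K_{(s,\gamma,w)}=\sum_{\delta(s,\gamma^*,w)^c\preccurlyeq\beta\preccurlyeq\delta(s,\gamma,w)}(-1)^{\ell(\beta)-\ell(\delta(s,\gamma,w))}F_\beta .$$
   Context: Let $\mathbb N=\{1,2,\dots\}$. A labelling of a finite poset $P$ is an injective map $\gamma$ from $P$ to a chain $c$; the dual labelling $\gamma^*:P\to c^*$ has the same values, where $c^*$ is $c$ with the reversed order. A weight function is $w:P\to\mathbb N$. A $(P,\gamma)$-partition is $f:P\to\mathbb N$ with, for all $p<q$, $f(p)\le f(q)$ and $f(p)=f(q)\Rightarrow\gamma(p)<\gamma(q)$ (comparison in the target chain). $K_{(P,\gamma,w)}=\sum_f\prod_{u\in P}x_{f(u)}^{w(u)}$ over all $(P,\gamma)$-partitions. A weighted labelled chain has $P=s$ a finite chain $u_1<\dots<u_\ell$; $w(s)=\sum_jw(u_j)$. For $\alpha\vDash n$ (composition of $n$), $\ell(\alpha)$ is its number of parts, $\mathrm{set}(\alpha)=\{\alpha_1,\alpha_1+\alpha_2,\dots,\alpha_1+\dots+\alpha_{\ell(\alpha)-1}\}\subseteq[n-1]$, $\mathrm{comp}$ is the inverse bijection, and $\alpha^c=\mathrm{comp}([n-1]\setminus\mathrm{set}(\alpha))$. For compositions of the same size, $\alpha\preccurlyeq\beta$ means $\mathrm{set}(\beta)\subseteq\mathrm{set}(\alpha)$. $\delta(s,\gamma,w)=\mathrm{comp}(\{\sum_{j=1}^kw(u_j):1\le k<\ell,\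 \gamma(u_k)>\gamma(u_{k+1})\})\vDash w(s)$ (and similarly for $\gamma^*$). $F_\beta=\sum x_{i_1}\cdots x_{i_n}$ over $i_1\le\dots\le i_n$ with $i_j<i_{j+1}$ whenever $j\in\mathrm{set}(\beta)$. -}

module Defs where

open import Level using (Level)
open import Data.Bool using (Bool; true; false)
open import Data.Nat as ℕ using (ℕ; zero; suc; _∸_)
import Data.Nat.Properties as ℕP
open import Data.Nat.ListAction using (sum)
open import Data.Fin as Fin using (Fin; toℕ)
import Data.Fin.Properties as FinP
open import Data.Fin.Subset using (Subset; _∈_; _⊆_; ∁; ∣_∣)
open import Data.Fin.Subset.Properties using (_∈?_; _⊆?_)
open import Data.Integer as ℤ using (ℤ; +_; -1ℤ)
open import Data.List as List using (List; []; _∷_; filter; length; concatMap; allFin)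
open import Data.Vec as Vec using (Vec; tabulate)
import Data.Vec.Properties as VecP
import Data.Vec.Functional as VF
open import Data.Product using (Σ; ∃; _×_; _,_)
open import Function using (flip; _$_)
open import Relation.Binary using (Rel; Decidable; StrictTotalOrder)
open import Relation.Binary.PropositionalEquality using (_≡_)
open import Relation.Nullary using (Dec; does)
open import Relation.Nullary.Decidable using (_×-dec_; _→-dec_)

allFuns : (ℓ m : ℕ) → List (Fin ℓ → Fin m)
allFuns zero    m = (λ ()) ∷ []
allFuns (suc ℓ) m =
  concatMap (λ f → List.map (λ j → j VF.∷ f) (allFin m)) (allFuns ℓ m)

allSubsets : (n : ℕ) → List (Subset n)
allSubsets zero    = Vec.[] ∷ []
allSubsets (suc n) =
  concatMap (λ S → (true Vec.∷ S) ∷ (false Vec.∷ S) ∷ []) (allSubsets n)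

sumℤ : List ℤ → ℤ
sumℤ = List.foldr ℤ._+_ (+ 0)

ΣFin : (ℓ : ℕ) → (Fin ℓ → ℕ) → ℕ
ΣFin ℓ g = sum (List.map g (allFin ℓ))

-- Formal power series in x₁, x₂, … (integer coefficients), given by their
-- coefficients: S m a is the coefficient of x₁^{a₁} ⋯ x_m^{a_m}
-- (a : Vec ℕ m; index t : Fin m stands for the variable x_{t+1}).

Series : Set
Series = (m : ℕ) → Vec ℕ m → ℤ

-- exponent vector of ∏_{u} x_{f(u)+1}^{w(u)}  for f : Fin ℓ → Fin m
expo : {ℓ m : ℕ} → (Fin ℓ → ℕ) → (Fin ℓ → Fin m) → Vec ℕ m
expo {ℓ} w f = tabulate λ t → ΣFin ℓ (λ u → if′ (f u) t (w u))
  where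
  if′ : {m : ℕ} → Fin m → Fin m → ℕ → ℕ
  if′ i t x with does (i Fin.≟ t)
  ... | true  = x
  ... | false = 0

-- Compositions of n are represented by their set  set(α) ⊆ [n-1]
-- (the paper's bijection set/comp).  Subset (n ∸ 1): index t : Fin (n ∸ 1)
-- stands for the number t+1 ∈ [n-1].

record Comp (n : ℕ) : Set where
  constructor comp
  field set : Subset (n ∸ 1)
open Comp public

allComps : (n : ℕ) → List (Comp n)
allComps n = List.map comp (allSubsets (n ∸ 1))

len : (n : ℕ) → Comp n → ℕ
len zero    _ = 0
len (suc n) α = suc ∣ set α ∣

_≼_ : {n : ℕ} → Comp n → Comp n → Set
α ≼ β = set β ⊆ set α

_≼?_ : {n : ℕ} (α β : Comp n) → Dec (α ≼ β)
α ≼? β = set β ⊆? set α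

_ᶜ : {n : ℕ} → Comp n → Comp n
α ᶜ = comp (∁ (set α))

_∈ℕ_ : {k : ℕ} → ℕ → Subset k → Set
x ∈ℕ S = ∃ λ t → t ∈ S × suc (toℕ t) ≡ x

_∈ℕ?_ : {k : ℕ} (x : ℕ) (S : Subset k) → Dec (x ∈ℕ S)
x ∈ℕ? S = FinP.any? (λ t → (t ∈? S) ×-dec (suc (toℕ t) ℕ.≟ x))

-- Weighted labelled chain: s = u₁ < ⋯ < u_ℓ  is Fin ℓ (u_{k+1} ↔ k),
-- γ : Fin ℓ → Carrier C is the labelling into the chain C,
-- w : Fin ℓ → ℕ the weight function.

wt : {ℓ : ℕ} → (Fin ℓ → ℕ) → ℕ
wt {ℓ} w = ΣFin ℓ w

psum : {ℓ : ℕ} → (Fin ℓ → ℕ) → Fin ℓ → ℕ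
psum {ℓ} w k = ΣFin ℓ (λ j → if≤ j)
  where
  if≤ : Fin ℓ → ℕ
  if≤ j with does (toℕ j ℕ.≤? toℕ k)
  ... | true  = w j
  ... | false = 0

module _ {a r : Level} {A : Set a} (_<c_ : Rel A r) (_<c?_ : Decidable _<c_) where

  IsDesAt : {ℓ : ℕ} → (Fin ℓ → A) → (Fin ℓ → ℕ) → ℕ → Set r
  IsDesAt {ℓ} γ w x =
    Σ (Fin ℓ) λ k → Σ (Fin ℓ) λ k′ →
      (toℕ k′ ≡ suc (toℕ k)) × (psum w k ≡ x) × (γ k′ <c γ k)

  IsDesAt? : {ℓ : ℕ} (γ : Fin ℓ → A) (w : Fin ℓ → ℕ) (x : ℕ) → Dec (IsDesAt γ w x)
  IsDesAt? γ w x = FinP.any? λ k → FinP.any? λ k′ →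
    (toℕ k′ ℕ.≟ suc (toℕ k)) ×-dec ((psum w k ℕ.≟ x) ×-dec (γ k′ <c? γ k))

  δ : {ℓ : ℕ} → (Fin ℓ → A) → (w : Fin ℓ → ℕ) → Comp (wt w)
  δ γ w = comp $ tabulate λ t → does (IsDesAt? γ w (suc (toℕ t)))

  -- (P,γ)-partitions of the chain, with values in {1,…,m}
  -- (f u = t : Fin m stands for the value t+1)
  IsPartition : {ℓ m : ℕ} → (Fin ℓ → A) → (Fin ℓ → Fin m) → Set r
  IsPartition {ℓ} γ f = (p q : Fin ℓ) → p Fin.< q →
    (f p Fin.≤ f q) × (f p ≡ f q → γ p <c γ q)

  IsPartition? : {ℓ m : ℕ} (γ : Fin ℓ → A) (f : Fin ℓ → Fin m) → Dec (IsPartition γ f)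
  IsPartition? γ f = FinP.all? λ p → FinP.all? λ q →
    (p Fin.<? q) →-dec ((f p Fin.≤? f q) ×-dec ((f p Fin.≟ f q) →-dec (γ p <c? γ q)))

  K : {ℓ : ℕ} → (Fin ℓ → A) → (Fin ℓ → ℕ) → Series
  K {ℓ} γ w m a = + length (filter (λ f → IsPartition? γ f ×-dec VecP.≡-dec ℕ._≟_ (expo w f) a)
                                   (allFuns ℓ m))

-- Fundamental quasisymmetric function F_β (β ⊨ n): coefficient of x^a is
-- the number of i₁ ≤ ⋯ ≤ i_n (i_j < i_{j+1} when j ∈ set(β)) with
-- x_{i₁}⋯x_{i_n} = x^a.  (0-based: position j : Fin n is i_{j+1}.)

IsFSeq : {n m : ℕ} → Comp n → (Fin n → Fin m) → Set
IsFSeq {n} β i = (j j′ : Fin n) → toℕ j′ ≡ suc (toℕ j) →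
  (i j Fin.≤ i j′) × (suc (toℕ j) ∈ℕ set β → i j Fin.< i j′)

IsFSeq? : {n m : ℕ} (β : Comp n) (i : Fin n → Fin m) → Dec (IsFSeq β i)
IsFSeq? β i = FinP.all? λ j → FinP.all? λ j′ →
  (toℕ j′ ℕ.≟ suc (toℕ j)) →-dec ((i j Fin.≤? i j′) ×-dec ((suc (toℕ j) ∈ℕ? set β) →-dec (i j Fin.<? i j′)))

F : (n : ℕ) → Comp n → Series
F n β m a = + length (filter (λ i → IsFSeq? β i ×-dec VecP.≡-dec ℕ._≟_ (expo (λ _ → 1) i) a)
                             (allFuns n m))

-- The dual labelling γ* has the same values
-- in the reversed chain, i.e. strict order  flip _<_.

module _ {c ℓ₁ ℓ₂ : Level} (C : StrictTotalOrder c ℓ₁ ℓ₂) where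
  open StrictTotalOrder C

  δγ : {ℓ : ℕ} → (Fin ℓ → Carrier) → (w : Fin ℓ → ℕ) → Comp (wt w)
  δγ = δ _<_ _<?_

  δγ* : {ℓ : ℕ} → (Fin ℓ → Carrier) → (w : Fin ℓ → ℕ) → Comp (wt w)
  δγ* = δ (flip _<_) (flip _<?_)

  Kchain : {ℓ : ℕ} → (Fin ℓ → Carrier) → (Fin ℓ → ℕ) → Series
  Kchain = K _<_ _<?_

  RHS : {ℓ : ℕ} → (Fin ℓ → Carrier) → (Fin ℓ → ℕ) → Series
  RHS γ w m a =
    sumℤ (List.map (λ β → (-1ℤ ℤ.^ (len (wt w) β ∸ len (wt w) (δγ γ w))) ℤ.* F (wt w) β m a)
      (filter (λ β → ((δγ* γ w ᶜ) ≼? β) ×-dec (β ≼? δγ γ w))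
              (allComps (wt w))))

-- Blow every element u of the chain up into w(u) consecutive positions of [0, n), n = w(s).
-- Precomposing with "the block containing j" maps the (s,γ)-partitions with monomial x^a
-- bijectively onto the weakly increasing sequences i : [0, n) → [m] with content a that are
-- constant inside blocks and strictly increase across every descent of γ between two blocks;
-- equivalently, whose strict positions meet the non-ascents set(δ(s,γ*,w))ᶜ exactly in
-- set(δ(s,γ,w)).  On the other side F_β counts weakly increasing sequences strict on set(β);
-- exchanging the two sums, a sequence i contributes the alternating sum of (-1)^{|S|-|set δ(s,γ,w)|}
-- over the interval set(δ(s,γ,w)) ⊆ S ⊆ set(δ(s,γ*,w))ᶜ ∩ strict(i) of the Boolean lattice,
-- which is 1 if that interval is a single point and 0 otherwise.

module Submission where

open import Level using (Level)
open import Algebra.Bundles using (CommutativeSemiring)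
open import Data.Bool as Bool using (Bool; true; false; _∧_; not; if_then_else_)
open import Data.Empty using (⊥-elim)
open import Data.Fin as Fin using (Fin; toℕ)
import Data.Fin.Properties as FinP
open import Data.Fin.Subset using (Subset; ∣_∣; _∈_; _⊆_; ∁; _∩_)
open import Data.Fin.Subset.Properties using (_⊆?_; p⊆q⇒∣p∣≤∣q∣; x∈p∩q⁺; x∈p∩q⁻)
open import Data.Integer as ℤ using (ℤ; +_; -1ℤ)
import Data.Integer.Properties as ℤP
open import Data.Integer.Tactic.RingSolver using (solve-∀)
open import Data.List as List using (List; []; _∷_; _++_; concatMap; allFin; filter; length)
import Data.List.Properties as ListP
open import Data.Nat as ℕ using (ℕ; zero; suc; _≤_; _<_; _≤?_; _<?_; _∸_; s≤s; z≤n)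
import Data.Nat.Properties as ℕP
open import Data.Product using (Σ; ∃; _×_; _,_; proj₁; proj₂)
open import Data.Sum using (_⊎_; inj₁; inj₂; [_,_])
open import Data.Vec as Vec using (Vec; []; _∷_)
import Data.Vec.Functional as VF
import Data.Vec.Properties as VecP
open import Function using (_∘_; flip)
open import Function.Bundles using (_⇔_; mk⇔; Equivalence)
open import Function.Properties.Equivalence using () renaming (trans to ⇔-trans)
open import Relation.Binary using (DecidableEquality; Rel; Transitive; StrictTotalOrder; tri<; tri≈; tri>)
  renaming (Decidable to Decidable₂)
open import Relation.Binary.PropositionalEquality as ≡ using (_≡_; _≢_; subst; subst₂)
open import Relation.Nullary using (¬_; does; Dec; yes; no)
open import Relation.Nullary.Decidable using (_×-dec_; _→-dec_; does-⇔; dec-true; dec-false)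
open import Relation.Unary using (Pred; Decidable)

open import Defs

does≡true⇒ : {p : Level} {P : Set p} (P? : Dec P) → does P? ≡ true → P
does≡true⇒ (yes p) _  = p
does≡true⇒ (no _)  ()

does≡false⇒ : {p : Level} {P : Set p} (P? : Dec P) → does P? ≡ false → ¬ P
does≡false⇒ (yes _)  ()
does≡false⇒ (no ¬p) _ = ¬p

≡⇔lookup : {A : Set} {k : ℕ} (xs ys : Vec A k) → xs ≡ ys ⇔ (∀ t → Vec.lookup xs t ≡ Vec.lookup ys t)
≡⇔lookup xs ys = mk⇔ (λ xs≡ys t → ≡.cong (λ v → Vec.lookup v t) xs≡ys) λ pointwise → begin
  xs                          ≡⟨ VecP.tabulate∘lookup xs ⟨
  Vec.tabulate (Vec.lookup xs) ≡⟨ VecP.tabulate-cong pointwise ⟩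
  Vec.tabulate (Vec.lookup ys) ≡⟨ VecP.tabulate∘lookup ys ⟩
  ys                          ∎
  where open ≡.≡-Reasoning

module ListSum {c ℓ} (R : CommutativeSemiring c ℓ) where
  open CommutativeSemiring R
  open import Relation.Binary.Reasoning.Setoid setoid

  ∑ : {A : Set} → List A → (A → Carrier) → Carrier
  ∑ xs f = List.foldr _+_ 0# (List.map f xs)

  𝟙 : Bool → Carrier
  𝟙 b = if b then 1# else 0#

  𝟙-∧ : ∀ a b → 𝟙 (a ∧ b) ≈ 𝟙 a * 𝟙 b
  𝟙-∧ true  b = sym (*-identityˡ _)
  𝟙-∧ false b = sym (zeroˡ _)

  𝟙-⊎ : {p q r : Level} {P : Set p} {Q : Set q} {R : Set r} (P? : Dec P) (Q? : Dec Q) (R? : Dec R) →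
        (P → Q ⊎ R) → (Q ⊎ R → P) → ¬ (Q × R) → 𝟙 (does P?) ≈ 𝟙 (does Q?) + 𝟙 (does R?)
  𝟙-⊎ (yes _) (yes q) (yes r) _  _    disj = ⊥-elim (disj (q , r))
  𝟙-⊎ (yes _) (yes _) (no _)  _  _    _    = sym (+-identityʳ 1#)
  𝟙-⊎ (yes _) (no _)  (yes _) _  _    _    = sym (+-identityˡ 1#)
  𝟙-⊎ (yes p) (no ¬q) (no ¬r) to _    _    = ⊥-elim ([ ¬q , ¬r ] (to p))
  𝟙-⊎ (no ¬p) (yes q) _       _  from _    = ⊥-elim (¬p (from (inj₁ q)))
  𝟙-⊎ (no ¬p) (no _)  (yes r) _  from _    = ⊥-elim (¬p (from (inj₂ r)))
  𝟙-⊎ (no _)  (no _)  (no _)  _  _    _    = sym (+-identityˡ 0#)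

  module _ {A : Set} where

    ∑-cong : (xs : List A) {f g : A → Carrier} → (∀ x → f x ≈ g x) → ∑ xs f ≈ ∑ xs g
    ∑-cong []       f≈g = refl
    ∑-cong (x ∷ xs) f≈g = +-cong (f≈g x) (∑-cong xs f≈g)

    ∑-++ : (xs ys : List A) (f : A → Carrier) → ∑ (xs ++ ys) f ≈ ∑ xs f + ∑ ys f
    ∑-++ []       ys f = sym (+-identityˡ _)
    ∑-++ (x ∷ xs) ys f = trans (+-congˡ (∑-++ xs ys f)) (sym (+-assoc _ _ _))

    ∑-zero : (xs : List A) → ∑ xs (λ _ → 0#) ≈ 0#
    ∑-zero []       = refl
    ∑-zero (x ∷ xs) = trans (+-identityˡ _) (∑-zero xs)

    ∑-distrib-+ : (xs : List A) (f g : A → Carrier) → ∑ xs (λ x → f x + g x) ≈ ∑ xs f + ∑ xs g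
    ∑-distrib-+ []       f g = sym (+-identityˡ _)
    ∑-distrib-+ (x ∷ xs) f g = begin
      (f x + g x) + ∑ xs (λ x → f x + g x) ≈⟨ +-congˡ (∑-distrib-+ xs f g) ⟩
      (f x + g x) + (∑ xs f + ∑ xs g)      ≈⟨ +-assoc _ _ _ ⟩
      f x + (g x + (∑ xs f + ∑ xs g))      ≈⟨ +-congˡ (x+[y+z]≈y+[x+z] _ _ _) ⟩
      f x + (∑ xs f + (g x + ∑ xs g))      ≈⟨ +-assoc _ _ _ ⟨
      (f x + ∑ xs f) + (g x + ∑ xs g)      ∎
      where
      x+[y+z]≈y+[x+z] : ∀ a b d → a + (b + d) ≈ b + (a + d)
      x+[y+z]≈y+[x+z] a b d =
        trans (sym (+-assoc a b d)) (trans (+-congʳ (+-comm a b)) (+-assoc b a d))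

    ∑-distribˡ : (xs : List A) (a : Carrier) (f : A → Carrier) → a * ∑ xs f ≈ ∑ xs (λ x → a * f x)
    ∑-distribˡ []       a f = zeroʳ a
    ∑-distribˡ (x ∷ xs) a f = trans (distribˡ a _ _) (+-congˡ (∑-distribˡ xs a f))

    ∑-distribʳ : (xs : List A) (a : Carrier) (f : A → Carrier) → ∑ xs f * a ≈ ∑ xs (λ x → f x * a)
    ∑-distribʳ xs a f =
      trans (*-comm _ a) (trans (∑-distribˡ xs a f) (∑-cong xs (λ x → *-comm a (f x))))

    ∑-filter : {p : Level} {P : Pred A p} (P? : Decidable P) (xs : List A) (f : A → Carrier) →
               ∑ (filter P? xs) f ≈ ∑ xs (λ x → 𝟙 (does (P? x)) * f x)
    ∑-filter P? []       f = refl
    ∑-filter P? (x ∷ xs) f with does (P? x)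
    ... | true  = +-cong (sym (*-identityˡ _)) (∑-filter P? xs f)
    ... | false = trans (∑-filter P? xs f) (trans (sym (+-identityˡ _)) (+-congʳ (sym (zeroˡ _))))

  module _ {A B : Set} where

    ∑-map : (h : A → B) (xs : List A) (f : B → Carrier) → ∑ (List.map h xs) f ≈ ∑ xs (f ∘ h)
    ∑-map h []       f = refl
    ∑-map h (x ∷ xs) f = +-congˡ (∑-map h xs f)

    ∑-concatMap : (h : A → List B) (xs : List A) (f : B → Carrier) →
                  ∑ (concatMap h xs) f ≈ ∑ xs (λ x → ∑ (h x) f)
    ∑-concatMap h []       f = refl
    ∑-concatMap h (x ∷ xs) f = trans (∑-++ (h x) (concatMap h xs) f) (+-congˡ (∑-concatMap h xs f))

    ∑-comm : (xs : List A) (ys : List B) (g : A → B → Carrier) →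
             ∑ xs (λ x → ∑ ys (g x)) ≈ ∑ ys (λ y → ∑ xs (λ x → g x y))
    ∑-comm []       ys g = sym (∑-zero ys)
    ∑-comm (x ∷ xs) ys g = trans (+-congˡ (∑-comm xs ys g)) (sym (∑-distrib-+ ys (g x) _))

  ∑-allFin-suc : (n : ℕ) (f : Fin (suc n) → Carrier) →
                 ∑ (allFin (suc n)) f ≈ f Fin.zero + ∑ (allFin n) (f ∘ Fin.suc)
  ∑-allFin-suc n f = +-congˡ (begin
    ∑ (List.tabulate Fin.suc) f       ≡⟨ ≡.cong (λ xs → ∑ xs f) (ListP.map-tabulate (λ i → i) Fin.suc) ⟨
    ∑ (List.map Fin.suc (allFin n)) f ≈⟨ ∑-map Fin.suc (allFin n) f ⟩
    ∑ (allFin n) (f ∘ Fin.suc)        ∎)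

  ∑-allFin-δ : (n : ℕ) (c : Fin n) (f : Fin n → Carrier) →
               ∑ (allFin n) (λ j → 𝟙 (does (j Fin.≟ c)) * f j) ≈ f c
  ∑-allFin-δ (suc n) c f = trans (∑-allFin-suc n _) (go c)
    where
    go : (c : Fin (suc n)) → 𝟙 (does (Fin.zero Fin.≟ c)) * f Fin.zero
                               + ∑ (allFin n) (λ j → 𝟙 (does (Fin.suc j Fin.≟ c)) * f (Fin.suc j)) ≈ f c
    go Fin.zero = trans (+-cong (*-identityˡ _) (trans (∑-cong (allFin n) (λ j → zeroˡ _)) (∑-zero (allFin n))))
                        (+-identityʳ _)
    go (Fin.suc c) = trans (+-congʳ (zeroˡ _)) (trans (+-identityˡ _) (∑-allFin-δ n c (f ∘ Fin.suc)))

  _≗?_ : {ℓ m : ℕ} (f g : Fin ℓ → Fin m) → Dec (∀ u → f u ≡ g u)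
  f ≗? g = FinP.all? (λ u → f u Fin.≟ g u)

  ∑-allFuns-≗ : (ℓ m : ℕ) (g : Fin ℓ → Fin m) → ∑ (allFuns ℓ m) (λ f → 𝟙 (does (f ≗? g))) ≈ 1#
  ∑-allFuns-≗ zero    m g = +-identityʳ _
  ∑-allFuns-≗ (suc ℓ) m g = begin
    ∑ (allFuns (suc ℓ) m) (λ f → 𝟙 (does (f ≗? g)))
      ≈⟨ ∑-concatMap _ (allFuns ℓ m) _ ⟩
    ∑ (allFuns ℓ m) (λ f → ∑ (List.map (VF._∷ f) (allFin m)) (λ h → 𝟙 (does (h ≗? g))))
      ≈⟨ ∑-cong (allFuns ℓ m) (λ f → ∑-map _ (allFin m) _) ⟩
    ∑ (allFuns ℓ m) (λ f → ∑ (allFin m) (λ j → 𝟙 (does (j Fin.≟ g₀) ∧ does (f ≗? g₊))))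
      ≈⟨ ∑-cong (allFuns ℓ m) (λ f → ∑-cong (allFin m) (λ j → 𝟙-∧ _ _)) ⟩
    ∑ (allFuns ℓ m) (λ f → ∑ (allFin m) (λ j → 𝟙 (does (j Fin.≟ g₀)) * 𝟙 (does (f ≗? g₊))))
      ≈⟨ ∑-cong (allFuns ℓ m) (λ f → ∑-allFin-δ m g₀ _) ⟩
    ∑ (allFuns ℓ m) (λ f → 𝟙 (does (f ≗? g₊)))
      ≈⟨ ∑-allFuns-≗ ℓ m g₊ ⟩
    1# ∎
    where
    g₀ = g Fin.zero
    g₊ = g ∘ Fin.suc

  ∑-expand-≗ : {ℓ n m : ℕ} (a : (Fin ℓ → Fin m) → Carrier) (φ : (Fin ℓ → Fin m) → Fin n → Fin m) →
               ∑ (allFuns ℓ m) a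
               ≈ ∑ (allFuns ℓ m) (λ f → ∑ (allFuns n m) (λ i → a f * 𝟙 (does (i ≗? φ f))))
  ∑-expand-≗ {ℓ} {n} {m} a φ = ∑-cong (allFuns ℓ m) λ f → begin
    a f                                                 ≈⟨ *-identityʳ (a f) ⟨
    a f * 1#                                            ≈⟨ *-congˡ (∑-allFuns-≗ n m (φ f)) ⟨
    a f * ∑ (allFuns n m) (λ i → 𝟙 (does (i ≗? φ f)))   ≈⟨ ∑-distribˡ (allFuns n m) (a f) _ ⟩
    ∑ (allFuns n m) (λ i → a f * 𝟙 (does (i ≗? φ f)))   ∎

  module _ {ℓ n m : ℕ} {p q : Level}
           {P : Pred (Fin ℓ → Fin m) p} {Q : Pred (Fin n → Fin m) q}
           (P? : Decidable P) (Q? : Decidable Q)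
           (P-resp : ∀ {f g} → (∀ u → f u ≡ g u) → P f → P g)
           (Q-resp : ∀ {i j} → (∀ x → i x ≡ j x) → Q i → Q j)
           (β : Fin n → Fin ℓ) (α : Fin ℓ → Fin n) (β∘α : ∀ u → β (α u) ≡ u)
           (P⇒Q : ∀ f → P f → Q (f ∘ β))
           (Q⇒P : ∀ i → Q i → P (i ∘ α))
           (Q⇒α∘β : ∀ i → Q i → ∀ x → i (α (β x)) ≡ i x)
    where

    private
      fibres : ∀ f i → P f × (∀ x → i x ≡ f (β x)) → Q i × (∀ u → f u ≡ i (α u))
      fibres f i (Pf , i≗fβ) =
        Q-resp (λ x → ≡.sym (i≗fβ x)) (P⇒Q f Pf)
        , λ u → ≡.trans (≡.cong f (≡.sym (β∘α u))) (≡.sym (i≗fβ (α u)))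

      fibres⁻ : ∀ f i → Q i × (∀ u → f u ≡ i (α u)) → P f × (∀ x → i x ≡ f (β x))
      fibres⁻ f i (Qi , f≗iα) =
        P-resp (λ u → ≡.sym (f≗iα u)) (Q⇒P i Qi)
        , λ x → ≡.trans (≡.sym (Q⇒α∘β i Qi x)) (≡.sym (f≗iα (β x)))

      swap-fibre : ∀ f i → 𝟙 (does (P? f)) * 𝟙 (does (i ≗? (f ∘ β)))
                         ≈ 𝟙 (does (Q? i)) * 𝟙 (does (f ≗? (i ∘ α)))
      swap-fibre f i = begin
        𝟙 (does (P? f)) * 𝟙 (does (i ≗? (f ∘ β)))   ≈⟨ 𝟙-∧ _ _ ⟨
        𝟙 (does (P?f×i≗fβ))                        ≡⟨ ≡.cong 𝟙 (does-⇔ (mk⇔ (fibres f i) (fibres⁻ f i)) P?f×i≗fβ Q?i×f≗iα) ⟩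
        𝟙 (does (Q?i×f≗iα))                        ≈⟨ 𝟙-∧ _ _ ⟩
        𝟙 (does (Q? i)) * 𝟙 (does (f ≗? (i ∘ α)))   ∎
        where
        P?f×i≗fβ = P? f ×-dec i ≗? (f ∘ β)
        Q?i×f≗iα = Q? i ×-dec f ≗? (i ∘ α)

    ∑-reindex : ∑ (allFuns ℓ m) (λ f → 𝟙 (does (P? f))) ≈ ∑ (allFuns n m) (λ i → 𝟙 (does (Q? i)))
    ∑-reindex = begin
      ∑ (allFuns ℓ m) (λ f → 𝟙 (does (P? f)))
        ≈⟨ ∑-expand-≗ _ (_∘ β) ⟩
      ∑ (allFuns ℓ m) (λ f → ∑ (allFuns n m) (λ i → 𝟙 (does (P? f)) * 𝟙 (does (i ≗? (f ∘ β)))))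
        ≈⟨ ∑-cong (allFuns ℓ m) (λ f → ∑-cong (allFuns n m) (swap-fibre f)) ⟩
      ∑ (allFuns ℓ m) (λ f → ∑ (allFuns n m) (λ i → 𝟙 (does (Q? i)) * 𝟙 (does (f ≗? (i ∘ α)))))
        ≈⟨ ∑-comm (allFuns ℓ m) (allFuns n m) _ ⟩
      ∑ (allFuns n m) (λ i → ∑ (allFuns ℓ m) (λ f → 𝟙 (does (Q? i)) * 𝟙 (does (f ≗? (i ∘ α)))))
        ≈⟨ ∑-expand-≗ _ (_∘ α) ⟨
      ∑ (allFuns n m) (λ i → 𝟙 (does (Q? i))) ∎

open ListSum ℤP.+-*-commutativeSemiring

module _ where
  open import Data.Integer using (_+_; _*_)

  count≡∑ : {A : Set} {p : Level} {P : Pred A p} (P? : Decidable P) (xs : List A) →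
            + length (filter P? xs) ≡ ∑ xs (λ x → 𝟙 (does (P? x)))
  count≡∑ P? []       = ≡.refl
  count≡∑ P? (x ∷ xs) with does (P? x)
  ... | true  = ≡.cong (_+_ (+ 1)) (count≡∑ P? xs)
  ... | false = ≡.trans (count≡∑ P? xs) (≡.sym (ℤP.+-identityˡ _))

  sign : ℕ → ℤ
  sign n = -1ℤ ℤ.^ n

  sign-∸ : ∀ a b → b ≤ a → sign (a ∸ b) ≡ sign a * sign b
  sign-∸ a       zero    _         = ≡.sym (ℤP.*-identityʳ _)
  sign-∸ (suc a) (suc b) (s≤s b≤a) = ≡.trans (sign-∸ a b b≤a) (-x*-y≡x*y (sign a) (sign b))
    where
    -x*-y≡x*y : ∀ (x y : ℤ) → x * y ≡ (-1ℤ * x) * (-1ℤ * y)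
    -x*-y≡x*y = solve-∀

  sign²≡1 : ∀ a → sign a * sign a ≡ + 1
  sign²≡1 zero    = ≡.refl
  sign²≡1 (suc a) = ≡.trans (-x*-x≡x*x (sign a)) (sign²≡1 a)
    where
    -x*-x≡x*x : ∀ (x : ℤ) → (-1ℤ * x) * (-1ℤ * x) ≡ x * x
    -x*-x≡x*x = solve-∀

  sign-len∸ : (k : ℕ) (S L : Subset (k ∸ 1)) → ∣ L ∣ ≤ ∣ S ∣ →
              sign (len k (comp S) ∸ len k (comp L)) ≡ sign ∣ S ∣ * sign ∣ L ∣
  sign-len∸ zero    []      []      _    = ≡.refl
  sign-len∸ (suc k) S       L       L≤S  = sign-∸ ∣ S ∣ ∣ L ∣ L≤S

  𝟙⊆-sign : (k : ℕ) (S L : Subset (k ∸ 1)) →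
            𝟙 (does (L ⊆? S)) * sign (len k (comp S) ∸ len k (comp L))
            ≡ 𝟙 (does (L ⊆? S)) * (sign ∣ S ∣ * sign ∣ L ∣)
  𝟙⊆-sign k S L with L ⊆? S
  ... | yes L⊆S = ≡.cong (_*_ (+ 1)) (sign-len∸ k S L (p⊆q⇒∣p∣≤∣q∣ L⊆S))
  ... | no  _   = ≡.trans (ℤP.*-zeroˡ (sign (len k (comp S) ∸ len k (comp L))))
                          (≡.sym (ℤP.*-zeroˡ (sign ∣ S ∣ * sign ∣ L ∣)))

  ⊆∩⇔ : {k : ℕ} (S A D : Subset k) → (S ⊆ A × S ⊆ D) ⇔ S ⊆ A ∩ D
  ⊆∩⇔ S A D = mk⇔ (λ (S⊆A , S⊆D) {_} x∈S → x∈p∩q⁺ (S⊆A x∈S , S⊆D x∈S))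
                  (λ S⊆A∩D → (λ {_} x∈S → proj₁ (x∈p∩q⁻ A D (S⊆A∩D x∈S)))
                           , (λ {_} x∈S → proj₂ (x∈p∩q⁻ A D (S⊆A∩D x∈S))))

  𝟙⊆∩ : {k : ℕ} (S A D : Subset k) →
        𝟙 (does (S ⊆? A)) * 𝟙 (does (S ⊆? D)) ≡ 𝟙 (does (S ⊆? A ∩ D))
  𝟙⊆∩ S A D = ≡.trans (≡.sym (𝟙-∧ (does (S ⊆? A)) (does (S ⊆? D))))
                      (≡.cong 𝟙 (does-⇔ (⊆∩⇔ S A D) ((S ⊆? A) ×-dec (S ⊆? D)) (S ⊆? A ∩ D)))

  _≟ₛ_ : {k : ℕ} → DecidableEquality (Subset k)
  _≟ₛ_ = VecP.≡-dec Bool._≟_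

  ∑-interval : (k : ℕ) (L B : Subset k) →
    ∑ (allSubsets k) (λ S → 𝟙 (does (L ⊆? S)) * 𝟙 (does (S ⊆? B)) * sign ∣ S ∣)
    ≡ 𝟙 (does (B ≟ₛ L)) * sign ∣ L ∣
  ∑-interval zero    []      []      = ≡.refl
  ∑-interval (suc k) (l ∷ L) (b ∷ B) = begin
    ∑ (allSubsets (suc k)) (summand (l ∷ L) (b ∷ B))
      ≡⟨ ∑-concatMap _ (allSubsets k) _ ⟩
    ∑ (allSubsets k) (λ S → summand (l ∷ L) (b ∷ B) (true ∷ S)
                          + (summand (l ∷ L) (b ∷ B) (false ∷ S) + + 0))
      ≡⟨ ∑-cong (allSubsets k) (split l b) ⟩
    ∑ (allSubsets k) (λ S → κ l b * summand L B S)
      ≡⟨ ∑-distribˡ (allSubsets k) (κ l b) _ ⟨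
    κ l b * ∑ (allSubsets k) (summand L B)
      ≡⟨ ≡.cong (κ l b *_) (∑-interval k L B) ⟩
    κ l b * (𝟙 (does (B ≟ₛ L)) * sign ∣ L ∣)
      ≡⟨ collect l b ⟩
    𝟙 (does ((b ∷ B) ≟ₛ (l ∷ L))) * sign ∣ l ∷ L ∣ ∎
    where
    open ≡.≡-Reasoning
    summand : {k : ℕ} → Subset k → Subset k → Subset k → ℤ
    summand L B S = 𝟙 (does (L ⊆? S)) * 𝟙 (does (S ⊆? B)) * sign ∣ S ∣

    -- ∑ of (-1)^x over x with l ≤ x ≤ b: the contribution of one coordinate
    κ : Bool → Bool → ℤ
    κ true  true  = -1ℤ
    κ false false = + 1
    κ _     _     = + 0

    split : ∀ l b S → summand (l ∷ L) (b ∷ B) (true ∷ S) + (summand (l ∷ L) (b ∷ B) (false ∷ S) + + 0)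
                      ≡ κ l b * summand L B S
    split true  true  S = e (𝟙 (does (L ⊆? S))) (𝟙 (does (S ⊆? B))) (sign ∣ S ∣)
      where e : ∀ x y s → x * y * (-1ℤ * s) + (+ 0 * y * s + + 0) ≡ -1ℤ * (x * y * s)
            e = solve-∀
    split true  false S = e (𝟙 (does (L ⊆? S))) (𝟙 (does (S ⊆? B))) (sign ∣ S ∣)
      where e : ∀ x y s → x * + 0 * (-1ℤ * s) + (+ 0 * y * s + + 0) ≡ + 0 * (x * y * s)
            e = solve-∀
    split false true  S = e (𝟙 (does (L ⊆? S))) (𝟙 (does (S ⊆? B))) (sign ∣ S ∣)
      where e : ∀ x y s → x * y * (-1ℤ * s) + (x * y * s + + 0) ≡ + 0 * (x * y * s)
            e = solve-∀
    split false false S = e (𝟙 (does (L ⊆? S))) (𝟙 (does (S ⊆? B))) (sign ∣ S ∣)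
      where e : ∀ x y s → x * + 0 * (-1ℤ * s) + (x * y * s + + 0) ≡ + 1 * (x * y * s)
            e = solve-∀

    collect : ∀ l b → κ l b * (𝟙 (does (B ≟ₛ L)) * sign ∣ L ∣)
                      ≡ 𝟙 (does ((b ∷ B) ≟ₛ (l ∷ L))) * sign ∣ l ∷ L ∣
    collect true  true  = e (𝟙 (does (B ≟ₛ L))) (sign ∣ L ∣)
      where e : ∀ x s → -1ℤ * (x * s) ≡ x * (-1ℤ * s)
            e = solve-∀
    collect true  false = ≡.trans (ℤP.*-zeroˡ (𝟙 (does (B ≟ₛ L)) * sign ∣ L ∣)) (≡.sym (ℤP.*-zeroˡ (-1ℤ * sign ∣ L ∣)))
    collect false true  = ≡.trans (ℤP.*-zeroˡ (𝟙 (does (B ≟ₛ L)) * sign ∣ L ∣)) (≡.sym (ℤP.*-zeroˡ (sign ∣ L ∣)))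
    collect false false = ℤP.*-identityˡ _

module N = ListSum ℕP.+-*-commutativeSemiring

∑-mono-≤ : {A : Set} (xs : List A) {f g : A → ℕ} → (∀ x → f x ≤ g x) → N.∑ xs f ≤ N.∑ xs g
∑-mono-≤ []       f≤g = z≤n
∑-mono-≤ (x ∷ xs) f≤g = ℕP.+-mono-≤ (f≤g x) (∑-mono-≤ xs f≤g)

Consecutive : {k : ℕ} → Fin k → Fin k → Set
Consecutive i j = toℕ j ≡ suc (toℕ i)

consecutive-distinct : {k : ℕ} {b b′ : Fin k} → Consecutive b b′ → b ≢ b′
consecutive-distinct {b = b} b⋯b′ ≡.refl = ℕP.<-irrefl b⋯b′ (ℕP.n<1+n (toℕ b))

module PrefixSums {ℓ : ℕ} (w : Fin ℓ → ℕ) where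

  private
    -- the summand of psum is local to its definition; this names it
    unfold : (k : Fin ℓ) → Σ (Fin ℓ → ℕ) (λ g → psum w k ≡ N.∑ (allFin ℓ) g)
    unfold k = _ , ≡.refl

    term : Fin ℓ → Fin ℓ → ℕ
    term k = proj₁ (unfold k)

    term-≤ : ∀ k j → toℕ j ≤ toℕ k → term k j ≡ w j
    term-≤ k j j≤k rewrite dec-true (toℕ j ≤? toℕ k) j≤k = ≡.refl

    term-≰ : ∀ k j → ¬ toℕ j ≤ toℕ k → term k j ≡ 0
    term-≰ k j j≰k rewrite dec-false (toℕ j ≤? toℕ k) j≰k = ≡.refl

    term≤w : ∀ k j → term k j ≤ w j
    term≤w k j with toℕ j ≤? toℕ k
    ... | yes j≤k = ℕP.≤-reflexive (term-≤ k j j≤k)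
    ... | no  j≰k = subst (_≤ w j) (≡.sym (term-≰ k j j≰k)) z≤n

    δ-term : (c j : Fin ℓ) → ℕ
    δ-term c j = N.𝟙 (does (j Fin.≟ c)) ℕ.* w j

    ∑-δ-term : ∀ c → N.∑ (allFin ℓ) (δ-term c) ≡ w c
    ∑-δ-term c = N.∑-allFin-δ ℓ c w

  psum≤wt : (k : Fin ℓ) → psum w k ≤ wt w
  psum≤wt k = ℕP.≤-trans (ℕP.≤-reflexive (proj₂ (unfold k))) (∑-mono-≤ (allFin ℓ) (term≤w k))

  w≤psum : (k : Fin ℓ) → w k ≤ psum w k
  w≤psum k = subst₂ _≤_ (∑-δ-term k) (≡.sym (proj₂ (unfold k))) (∑-mono-≤ (allFin ℓ) pointwise)
    where
    pointwise : ∀ j → δ-term k j ≤ term k j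
    pointwise j with j Fin.≟ k
    ... | yes ≡.refl = ℕP.≤-reflexive (≡.trans (ℕP.+-identityʳ (w k)) (≡.sym (term-≤ k k ℕP.≤-refl)))
    ... | no  _      = z≤n

  psum-last : (k : Fin ℓ) → (∀ j → toℕ j ≤ toℕ k) → psum w k ≡ wt w
  psum-last k k-max = ≡.trans (proj₂ (unfold k)) (N.∑-cong (allFin ℓ) (λ j → term-≤ k j (k-max j)))

  psum-first : (k : Fin ℓ) → toℕ k ≡ 0 → psum w k ≡ w k
  psum-first k k≡0 = ≡.trans (proj₂ (unfold k)) (≡.trans (N.∑-cong (allFin ℓ) pointwise) (∑-δ-term k))
    where
    pointwise : ∀ j → term k j ≡ δ-term k j
    pointwise j with j Fin.≟ k
    ... | yes ≡.refl = ≡.trans (term-≤ k k ℕP.≤-refl) (≡.sym (ℕP.+-identityʳ (w k)))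
    ... | no  j≢k    = term-≰ k j j≰k
      where
      j≰k : ¬ toℕ j ≤ toℕ k
      j≰k j≤k = j≢k (FinP.toℕ-injective
                      (≡.trans (ℕP.n≤0⇒n≡0 (subst (toℕ j ≤_) k≡0 j≤k)) (≡.sym k≡0)))

  psum-step : (k k′ : Fin ℓ) → Consecutive k k′ → psum w k′ ≡ psum w k ℕ.+ w k′
  psum-step k k′ k⋯k′ = begin
    psum w k′                                              ≡⟨ proj₂ (unfold k′) ⟩
    N.∑ (allFin ℓ) (term k′)                               ≡⟨ N.∑-cong (allFin ℓ) pointwise ⟩
    N.∑ (allFin ℓ) (λ j → term k j ℕ.+ δ-term k′ j)        ≡⟨ N.∑-distrib-+ (allFin ℓ) _ _ ⟩
    N.∑ (allFin ℓ) (term k) ℕ.+ N.∑ (allFin ℓ) (δ-term k′) ≡⟨ ≡.cong₂ ℕ._+_ (≡.sym (proj₂ (unfold k)))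
                                                                             (∑-δ-term k′) ⟩
    psum w k ℕ.+ w k′                                      ∎
    where
    open ≡.≡-Reasoning
    pointwise : ∀ j → term k′ j ≡ term k j ℕ.+ δ-term k′ j
    pointwise j with j Fin.≟ k′ | toℕ j ≤? toℕ k
    ... | yes ≡.refl | yes k′≤k = ⊥-elim (ℕP.<-irrefl ≡.refl (subst (_≤ toℕ k) k⋯k′ k′≤k))
    ... | yes ≡.refl | no  k′≰k = ≡.trans (term-≤ k′ k′ ℕP.≤-refl)
                                    (≡.sym (≡.cong₂ ℕ._+_ (term-≰ k k′ k′≰k) (ℕP.+-identityʳ (w k′))))
    ... | no  j≢k′   | yes j≤k  = ≡.trans (term-≤ k′ j (ℕP.≤-trans j≤k (ℕP.<⇒≤ (ℕP.≤-reflexive (≡.sym k⋯k′)))))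
                                    (≡.sym (≡.trans (≡.cong (ℕ._+ 0) (term-≤ k j j≤k)) (ℕP.+-identityʳ _)))
    ... | no  j≢k′   | no  j≰k  = ≡.trans (term-≰ k′ j j≰k′)
                                    (≡.sym (≡.cong (ℕ._+ 0) (term-≰ k j j≰k)))
      where
      j≰k′ : ¬ toℕ j ≤ toℕ k′
      j≰k′ j≤k′ = j≢k′ (FinP.toℕ-injective
                         (ℕP.≤-antisym j≤k′ (subst (_≤ toℕ j) (≡.sym k⋯k′) (ℕP.≰⇒> j≰k))))

  psum+w≤psum : (k k′ : Fin ℓ) → toℕ k < toℕ k′ → psum w k ℕ.+ w k′ ≤ psum w k′
  psum+w≤psum k k′ k<k′ =
    subst₂ _≤_ (≡.cong₂ ℕ._+_ (≡.sym (proj₂ (unfold k))) (∑-δ-term k′)) (≡.sym (proj₂ (unfold k′)))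
      (subst (_≤ N.∑ (allFin ℓ) (term k′)) (N.∑-distrib-+ (allFin ℓ) _ _) (∑-mono-≤ (allFin ℓ) pointwise))
    where
    pointwise : ∀ j → term k j ℕ.+ δ-term k′ j ≤ term k′ j
    pointwise j with j Fin.≟ k′ | toℕ j ≤? toℕ k
    ... | yes ≡.refl | yes k′≤k = ⊥-elim (ℕP.<⇒≱ k<k′ k′≤k)
    ... | yes ≡.refl | no  k′≰k = ℕP.≤-reflexive
                                    (≡.trans (≡.cong₂ ℕ._+_ (term-≰ k k′ k′≰k) (ℕP.+-identityʳ (w k′)))
                                             (≡.sym (term-≤ k′ k′ ℕP.≤-refl)))
    ... | no  j≢k′   | yes j≤k  = ℕP.≤-reflexive (≡.trans (≡.cong (ℕ._+ 0) (term-≤ k j j≤k))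
                                    (≡.trans (ℕP.+-identityʳ _) (≡.sym (term-≤ k′ j (ℕP.≤-trans j≤k (ℕP.<⇒≤ k<k′))))))
    ... | no  j≢k′   | no  j≰k  = ℕP.≤-trans (ℕP.≤-reflexive (≡.cong (ℕ._+ 0) (term-≰ k j j≰k))) z≤n

expo≡∑ : {ℓ m : ℕ} (w : Fin ℓ → ℕ) (f : Fin ℓ → Fin m) →
         expo w f ≡ Vec.tabulate (λ t → N.∑ (allFin ℓ) (λ u → N.𝟙 (does (f u Fin.≟ t)) ℕ.* w u))
expo≡∑ {ℓ} {m} w f = ≡.trans (proj₂ unfold) (VecP.tabulate-cong (λ t → N.∑-cong (allFin ℓ) (pointwise t)))
  where
  -- as for psum, this names the summand local to expo
  unfold : Σ (Fin m → Fin ℓ → ℕ) (λ G → expo w f ≡ Vec.tabulate (λ t → N.∑ (allFin ℓ) (G t)))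
  unfold = _ , ≡.refl
  pointwise : ∀ t u → proj₁ unfold t u ≡ N.𝟙 (does (f u Fin.≟ t)) ℕ.* w u
  pointwise t u with f u Fin.≟ t
  ... | yes _ = ≡.sym (ℕP.+-identityʳ (w u))
  ... | no  _ = ≡.refl

expo-cong : {ℓ m : ℕ} (w : Fin ℓ → ℕ) {f g : Fin ℓ → Fin m} → (∀ u → f u ≡ g u) → expo w f ≡ expo w g
expo-cong {ℓ} w {f} {g} f≗g = ≡.trans (expo≡∑ w f) (≡.trans (VecP.tabulate-cong λ t →
  N.∑-cong (allFin ℓ) (λ u → ≡.cong (λ v → N.𝟙 (does (v Fin.≟ t)) ℕ.* w u) (f≗g u))) (≡.sym (expo≡∑ w g)))

wt≤ : {ℓ : ℕ} (w : Fin ℓ → ℕ) {x : ℕ} → (∀ k → psum w k ≤ x) → wt w ≤ x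
wt≤ {zero}  w psum≤x = z≤n
wt≤ {suc ℓ} w {x} psum≤x =
  subst (_≤ x) (PrefixSums.psum-last w (Fin.fromℕ ℓ) below-last) (psum≤x (Fin.fromℕ ℓ))
  where
  below-last : ∀ j → toℕ j ≤ toℕ (Fin.fromℕ ℓ)
  below-last j = subst (toℕ j ≤_) (≡.sym (FinP.toℕ-fromℕ ℓ)) (FinP.toℕ≤pred[n] j)

∑-allFin-< : (k h : ℕ) → h ≤ k → N.∑ (allFin k) (λ j → N.𝟙 (does (toℕ j <? h))) ≡ h
∑-allFin-< zero    zero    z≤n       = ≡.refl
∑-allFin-< (suc k) zero    z≤n       =
  ≡.trans (N.∑-allFin-suc k (λ j → N.𝟙 (does (toℕ j <? 0)))) (N.∑-zero (allFin k))
∑-allFin-< (suc k) (suc h) (s≤s h≤k) =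
  ≡.trans (N.∑-allFin-suc k (λ j → N.𝟙 (does (toℕ j <? suc h)))) (≡.cong suc (∑-allFin-< k h h≤k))

module Blocks {ℓ : ℕ} (w : Fin ℓ → ℕ) (w>0 : ∀ u → 1 ≤ w u) where
  open PrefixSums w public

  n : ℕ
  n = wt w

  start : Fin ℓ → ℕ
  start u = psum w u ∸ w u

  start+w≡psum : (u : Fin ℓ) → start u ℕ.+ w u ≡ psum w u
  start+w≡psum u = ℕP.m∸n+n≡m (w≤psum u)

  start<psum : (u : Fin ℓ) → start u < psum w u
  start<psum u = subst (start u <_) (start+w≡psum u) (ℕP.m<m+n (start u) (w>0 u))

  psum≤start : (k k′ : Fin ℓ) → toℕ k < toℕ k′ → psum w k ≤ start k′
  psum≤start k k′ k<k′ = ℕP.m+n≤o⇒m≤o∸n (psum w k) (psum+w≤psum k k′ k<k′)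

  start-step : (k k′ : Fin ℓ) → Consecutive k k′ → start k′ ≡ psum w k
  start-step k k′ k⋯k′ = ≡.trans (≡.cong (_∸ w k′) (psum-step k k′ k⋯k′)) (ℕP.m+n∸n≡m (psum w k) (w k′))

  start-first : (k : Fin ℓ) → toℕ k ≡ 0 → start k ≡ 0
  start-first k k≡0 = ≡.trans (≡.cong (_∸ w k) (psum-first k k≡0)) (ℕP.n∸n≡0 (w k))

  psum-strictMono : (k k′ : Fin ℓ) → toℕ k < toℕ k′ → psum w k < psum w k′
  psum-strictMono k k′ k<k′ = ℕP.≤-<-trans (psum≤start k k′ k<k′) (start<psum k′)

  psum-injective : (k k′ : Fin ℓ) → psum w k ≡ psum w k′ → k ≡ k′
  psum-injective k k′ p≡p′ with ℕP.<-cmp (toℕ k) (toℕ k′)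
  ... | tri< k<k′ _ _ = ⊥-elim (ℕP.<-irrefl p≡p′ (psum-strictMono k k′ k<k′))
  ... | tri≈ _ k≡k′ _ = FinP.toℕ-injective k≡k′
  ... | tri> _ _ k′<k = ⊥-elim (ℕP.<-irrefl (≡.sym p≡p′) (psum-strictMono k′ k k′<k))

  InBlock : Fin ℓ → ℕ → Set
  InBlock u x = start u ≤ x × x < psum w u

  inBlock-unique : {x : ℕ} (u u′ : Fin ℓ) → InBlock u x → InBlock u′ x → u ≡ u′
  inBlock-unique u u′ (s≤x , x<p) (s′≤x , x<p′) with ℕP.<-cmp (toℕ u) (toℕ u′)
  ... | tri< u<u′ _ _ = ⊥-elim (ℕP.<⇒≱ x<p (ℕP.≤-trans (psum≤start u u′ u<u′) s′≤x))
  ... | tri≈ _ u≡u′ _ = FinP.toℕ-injective u≡u′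
  ... | tri> _ _ u′<u = ⊥-elim (ℕP.<⇒≱ x<p′ (ℕP.≤-trans (psum≤start u′ u u′<u) s≤x))

  -- the block of x is the first u with x < psum w u
  inBlock-exists : (x : ℕ) → x < n → ∃ λ u → InBlock u x
  inBlock-exists x x<n with FinP.¬∀⟶∃¬-smallest ℓ (λ k → psum w k ≤ x) (λ k → psum w k ≤? x) not-all-≤
    where
    not-all-≤ : ¬ (∀ k → psum w k ≤ x)
    not-all-≤ all-≤ = ℕP.<⇒≱ x<n (wt≤ w all-≤)
  ... | Fin.zero  , x≮psum , _      =
    Fin.zero , subst (_≤ x) (≡.sym (start-first Fin.zero ≡.refl)) z≤n , ℕP.≰⇒> x≮psum
  ... | Fin.suc k , x≮psum , below≤ =
    Fin.suc k , subst (_≤ x) (≡.sym (start-step k′ (Fin.suc k) k′⋯k)) (below≤ last) , ℕP.≰⇒> x≮psum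
    where
    last : Fin (suc (toℕ k))
    last = Fin.fromℕ (toℕ k)
    k′ : Fin ℓ
    k′ = Fin.inject last
    k′⋯k : Consecutive k′ (Fin.suc k)
    k′⋯k = ≡.cong suc (≡.sym (≡.trans (FinP.toℕ-inject last) (FinP.toℕ-fromℕ (toℕ k))))

  blockOf : Fin n → Fin ℓ
  blockOf j = proj₁ (inBlock-exists (toℕ j) (FinP.toℕ<n j))

  inBlock-blockOf : (j : Fin n) → InBlock (blockOf j) (toℕ j)
  inBlock-blockOf j = proj₂ (inBlock-exists (toℕ j) (FinP.toℕ<n j))

  blockOf-unique : (j : Fin n) (u : Fin ℓ) → InBlock u (toℕ j) → blockOf j ≡ u
  blockOf-unique j u = inBlock-unique (blockOf j) u (inBlock-blockOf j)

  start<n : (u : Fin ℓ) → start u < n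
  start<n u = ℕP.<-≤-trans (start<psum u) (psum≤wt u)

  startPos : Fin ℓ → Fin n
  startPos u = Fin.fromℕ< (start<n u)

  toℕ-startPos : (u : Fin ℓ) → toℕ (startPos u) ≡ start u
  toℕ-startPos u = FinP.toℕ-fromℕ< (start<n u)

  blockOf-startPos : (u : Fin ℓ) → blockOf (startPos u) ≡ u
  blockOf-startPos u = blockOf-unique (startPos u) u
    (ℕP.≤-reflexive (≡.sym (toℕ-startPos u)) , subst (_< psum w u) (≡.sym (toℕ-startPos u)) (start<psum u))

  block-size : (u : Fin ℓ) → N.∑ (allFin n) (λ j → N.𝟙 (does (u Fin.≟ blockOf j))) ≡ w u
  block-size u = ℕP.+-cancelʳ-≡ (start u) _ _ (begin
    N.∑ (allFin n) inBlock-u ℕ.+ start u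
      ≡⟨ ≡.cong (N.∑ (allFin n) inBlock-u ℕ.+_) (∑-allFin-< n (start u) (ℕP.<⇒≤ (start<n u))) ⟨
    N.∑ (allFin n) inBlock-u ℕ.+ N.∑ (allFin n) (below (start u))
      ≡⟨ N.∑-distrib-+ (allFin n) _ _ ⟨
    N.∑ (allFin n) (λ j → inBlock-u j ℕ.+ below (start u) j)
      ≡⟨ N.∑-cong (allFin n) below-psum ⟨
    N.∑ (allFin n) (below (psum w u))
      ≡⟨ ∑-allFin-< n (psum w u) (psum≤wt u) ⟩
    psum w u
      ≡⟨ start+w≡psum u ⟨
    start u ℕ.+ w u
      ≡⟨ ℕP.+-comm (start u) (w u) ⟩
    w u ℕ.+ start u ∎)
    where
    open ≡.≡-Reasoning
    inBlock-u : Fin n → ℕ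
    inBlock-u j = N.𝟙 (does (u Fin.≟ blockOf j))
    below : ℕ → Fin n → ℕ
    below h j = N.𝟙 (does (toℕ j <? h))
    below-psum : ∀ j → below (psum w u) j ≡ inBlock-u j ℕ.+ below (start u) j
    below-psum j = N.𝟙-⊎ (toℕ j <? psum w u) (u Fin.≟ blockOf j) (toℕ j <? start u) to from disjoint
      where
      to : toℕ j < psum w u → u ≡ blockOf j ⊎ toℕ j < start u
      to j<p with toℕ j <? start u
      ... | yes j<s = inj₂ j<s
      ... | no  j≮s = inj₁ (≡.sym (blockOf-unique j u (ℕP.≮⇒≥ j≮s , j<p)))
      from : u ≡ blockOf j ⊎ toℕ j < start u → toℕ j < psum w u
      from (inj₁ ≡.refl) = proj₂ (inBlock-blockOf j)
      from (inj₂ j<s)    = ℕP.<-trans j<s (start<psum u)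
      disjoint : ¬ (u ≡ blockOf j × toℕ j < start u)
      disjoint (≡.refl , j<s) = ℕP.<⇒≱ j<s (proj₁ (inBlock-blockOf j))

  ∑-blocks : (G : Fin ℓ → ℕ) → N.∑ (allFin n) (λ j → G (blockOf j)) ≡ N.∑ (allFin ℓ) (λ u → w u ℕ.* G u)
  ∑-blocks G = begin
    N.∑ (allFin n) (λ j → G (blockOf j))
      ≡⟨ N.∑-cong (allFin n) (λ j → N.∑-allFin-δ ℓ (blockOf j) G) ⟨
    N.∑ (allFin n) (λ j → N.∑ (allFin ℓ) (λ u → N.𝟙 (does (u Fin.≟ blockOf j)) ℕ.* G u))
      ≡⟨ N.∑-comm (allFin n) (allFin ℓ) _ ⟩
    N.∑ (allFin ℓ) (λ u → N.∑ (allFin n) (λ j → N.𝟙 (does (u Fin.≟ blockOf j)) ℕ.* G u))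
      ≡⟨ N.∑-cong (allFin ℓ) (λ u → N.∑-distribʳ (allFin n) (G u) _) ⟨
    N.∑ (allFin ℓ) (λ u → N.∑ (allFin n) (λ j → N.𝟙 (does (u Fin.≟ blockOf j))) ℕ.* G u)
      ≡⟨ N.∑-cong (allFin ℓ) (λ u → ≡.cong (ℕ._* G u) (block-size u)) ⟩
    N.∑ (allFin ℓ) (λ u → w u ℕ.* G u) ∎
    where open ≡.≡-Reasoning

  private
    1+[psum∸1]≡psum : (k : Fin ℓ) → suc (psum w k ∸ 1) ≡ psum w k
    1+[psum∸1]≡psum k = ≡.trans (ℕP.+-comm 1 _) (ℕP.m∸n+n≡m (ℕP.≤-trans (w>0 k) (w≤psum k)))

    psum∸1<n : (k : Fin ℓ) → psum w k ∸ 1 < n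
    psum∸1<n k = ℕP.<-≤-trans (ℕP.≤-reflexive (1+[psum∸1]≡psum k)) (psum≤wt k)

  lastPos : Fin ℓ → Fin n
  lastPos k = Fin.fromℕ< (psum∸1<n k)

  blockOf-lastPos : (k : Fin ℓ) → blockOf (lastPos k) ≡ k
  blockOf-lastPos k = blockOf-unique (lastPos k) k
    (subst (start k ≤_) (≡.sym toℕ-lastPos) (ℕP.≤-pred (subst (start k <_) (≡.sym (1+[psum∸1]≡psum k)) (start<psum k)))
    , subst (_< psum w k) (≡.sym toℕ-lastPos) (ℕP.≤-reflexive (1+[psum∸1]≡psum k)))
    where
    toℕ-lastPos : toℕ (lastPos k) ≡ psum w k ∸ 1
    toℕ-lastPos = FinP.toℕ-fromℕ< (psum∸1<n k)

  lastPos⋯startPos : (k k′ : Fin ℓ) → Consecutive k k′ → Consecutive (lastPos k) (startPos k′)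
  lastPos⋯startPos k k′ k⋯k′ = ≡.trans (toℕ-startPos k′) (≡.trans (start-step k k′ k⋯k′)
    (≡.trans (≡.sym (1+[psum∸1]≡psum k)) (≡.cong suc (≡.sym (FinP.toℕ-fromℕ< (psum∸1<n k))))))

  interior-not-psum : (u : Fin ℓ) {x : ℕ} → start u < x → x < psum w u → ∀ k → psum w k ≢ x
  interior-not-psum u s<x x<p k p≡x with ℕP.<-cmp (toℕ k) (toℕ u)
  ... | tri< k<u _ _ = ℕP.<-irrefl p≡x (ℕP.≤-<-trans (psum≤start k u k<u) s<x)
  ... | tri≈ _ k≡u _ = ℕP.<-irrefl (≡.sym p≡x) (subst (λ v → _ < psum w v) (≡.sym (FinP.toℕ-injective k≡u)) x<p)
  ... | tri> _ _ u<k = ℕP.<-irrefl (≡.sym p≡x) (ℕP.<-trans x<p (psum-strictMono u k u<k))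

  data Gap (j j′ : Fin n) : Set where
    inside : blockOf j ≡ blockOf j′ → (∀ k → psum w k ≢ toℕ j′) → Gap j j′
    across : Consecutive (blockOf j) (blockOf j′) → psum w (blockOf j) ≡ toℕ j′ → Gap j j′

  gap : (j j′ : Fin n) → Consecutive j j′ → Gap j j′
  gap j j′ j⋯j′ with ℕP.<-cmp (toℕ (blockOf j)) (toℕ (blockOf j′))
  ... | tri≈ _ b≡b′ _ = inside (FinP.toℕ-injective b≡b′) (interior-not-psum (blockOf j) s<j′ j′<p)
    where
    s<j′ : start (blockOf j) < toℕ j′
    s<j′ = ℕP.≤-<-trans (proj₁ (inBlock-blockOf j)) (subst (toℕ j <_) (≡.sym j⋯j′) (ℕP.n<1+n _))
    j′<p : toℕ j′ < psum w (blockOf j)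
    j′<p = subst (λ v → toℕ j′ < psum w v) (≡.sym (FinP.toℕ-injective b≡b′)) (proj₂ (inBlock-blockOf j′))
  ... | tri> _ _ b′<b = ⊥-elim (ℕP.<⇒≱ (proj₂ (inBlock-blockOf j′))
          (ℕP.≤-trans (psum≤start _ _ b′<b) (ℕP.≤-trans (proj₁ (inBlock-blockOf j)) j≤j′)))
    where
    j≤j′ : toℕ j ≤ toℕ j′
    j≤j′ = subst (toℕ j ≤_) (≡.sym j⋯j′) (ℕP.n≤1+n _)
  ... | tri< b<b′ _ _ = across b⋯b′ p≡j′
    where
    b = blockOf j
    b′ = blockOf j′
    p≡j′ : psum w b ≡ toℕ j′
    p≡j′ = ℕP.≤-antisym (ℕP.≤-trans (psum≤start b b′ b<b′) (proj₁ (inBlock-blockOf j′)))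
                         (subst (_≤ psum w b) (≡.sym j⋯j′) (proj₂ (inBlock-blockOf j)))
    b⋯b′ : Consecutive b b′
    b⋯b′ with ℕP.m≤n⇒m<n∨m≡n b<b′
    ... | inj₂ b+1≡b′ = ≡.sym b+1≡b′
    ... | inj₁ b+1<b′ = ⊥-elim (ℕP.<⇒≱
            (subst (_< psum w r) (≡.trans (start-step b r r≡b+1) p≡j′) (start<psum r))
            (ℕP.≤-trans (psum≤start r b′ (subst (_< toℕ b′) (≡.sym r≡b+1) b+1<b′)) (proj₁ (inBlock-blockOf j′))))
      where
      r : Fin ℓ
      r = Fin.fromℕ< (ℕP.<-trans b+1<b′ (FinP.toℕ<n b′))
      r≡b+1 : Consecutive b r
      r≡b+1 = FinP.toℕ-fromℕ< _

  expo-blockOf : {m : ℕ} (f : Fin ℓ → Fin m) → expo (λ _ → 1) (λ j → f (blockOf j)) ≡ expo w f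
  expo-blockOf f = begin
    expo (λ _ → 1) (λ j → f (blockOf j))
      ≡⟨ expo≡∑ (λ _ → 1) (λ j → f (blockOf j)) ⟩
    Vec.tabulate (λ t → N.∑ (allFin n) (λ j → N.𝟙 (does (f (blockOf j) Fin.≟ t)) ℕ.* 1))
      ≡⟨ VecP.tabulate-cong (λ t → ∑-blocks (λ u → N.𝟙 (does (f u Fin.≟ t)) ℕ.* 1)) ⟩
    Vec.tabulate (λ t → N.∑ (allFin ℓ) (λ u → w u ℕ.* (N.𝟙 (does (f u Fin.≟ t)) ℕ.* 1)))
      ≡⟨ VecP.tabulate-cong (λ t → N.∑-cong (allFin ℓ) (λ u → w*[x*1]≡x*w (w u) (N.𝟙 (does (f u Fin.≟ t))))) ⟩
    Vec.tabulate (λ t → N.∑ (allFin ℓ) (λ u → N.𝟙 (does (f u Fin.≟ t)) ℕ.* w u))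
      ≡⟨ expo≡∑ w f ⟨
    expo w f ∎
    where
    open ≡.≡-Reasoning
    w*[x*1]≡x*w : ∀ y x → y ℕ.* (x ℕ.* 1) ≡ x ℕ.* y
    w*[x*1]≡x*w y x = ≡.trans (≡.cong (y ℕ.*_) (ℕP.*-identityʳ x)) (ℕP.*-comm y x)

module _ {k m : ℕ} where

  WeaklyIncreasing : (Fin k → Fin m) → Set
  WeaklyIncreasing i = (j j′ : Fin k) → Consecutive j j′ → i j Fin.≤ i j′

  weaklyIncreasing? : (i : Fin k → Fin m) → Dec (WeaklyIncreasing i)
  weaklyIncreasing? i = FinP.all? λ j → FinP.all? λ j′ →
    (toℕ j′ ℕ.≟ suc (toℕ j)) →-dec (i j Fin.≤? i j′)

  weaklyIncreasing⇒monotone : {i : Fin k → Fin m} → WeaklyIncreasing i →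
                              (j j′ : Fin k) → toℕ j ≤ toℕ j′ → i j Fin.≤ i j′
  weaklyIncreasing⇒monotone {i} steps j j′ j≤j′ = go (toℕ j′ ∸ toℕ j) j′ (≡.sym (ℕP.m+[n∸m]≡n j≤j′))
    where
    go : ∀ d j′ → toℕ j′ ≡ toℕ j ℕ.+ d → i j Fin.≤ i j′
    go zero    j′ j′≡j   =
      ℕP.≤-reflexive (≡.cong (toℕ ∘ i) (FinP.toℕ-injective (≡.sym (≡.trans j′≡j (ℕP.+-identityʳ _)))))
    go (suc d) j′ j′≡j+d = ℕP.≤-trans (go d j₁ (FinP.toℕ-fromℕ< j+d<k)) (steps j₁ j′ j₁⋯j′)
      where
      j+d<k : toℕ j ℕ.+ d < k
      j+d<k = ℕP.<-trans (ℕP.≤-reflexive (≡.sym (≡.trans j′≡j+d (ℕP.+-suc _ d)))) (FinP.toℕ<n j′)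
      j₁ : Fin k
      j₁ = Fin.fromℕ< j+d<k
      j₁⋯j′ : Consecutive j₁ j′
      j₁⋯j′ = ≡.trans j′≡j+d (≡.trans (ℕP.+-suc _ d) (≡.cong suc (≡.sym (FinP.toℕ-fromℕ< j+d<k))))

  StrictAt : (Fin k → Fin m) → ℕ → Set
  StrictAt i x = (j j′ : Fin k) → Consecutive j j′ → suc (toℕ j) ≡ x → i j Fin.< i j′

  strictAt? : (i : Fin k → Fin m) (x : ℕ) → Dec (StrictAt i x)
  strictAt? i x = FinP.all? λ j → FinP.all? λ j′ →
    (toℕ j′ ℕ.≟ suc (toℕ j)) →-dec ((suc (toℕ j) ℕ.≟ x) →-dec (i j Fin.<? i j′))

  strictAt⇔ : (i : Fin k → Fin m) (j j′ : Fin k) → Consecutive j j′ →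
              StrictAt i (suc (toℕ j)) ⇔ (i j Fin.< i j′)
  strictAt⇔ i j j′ j⋯j′ = mk⇔ (λ strict → strict j j′ j⋯j′ ≡.refl) from
    where
    from : i j Fin.< i j′ → StrictAt i (suc (toℕ j))
    from i<i′ j₀ j₀′ j₀⋯j₀′ j₀≡j with FinP.toℕ-injective {i = j₀} {j = j} (ℕP.suc-injective j₀≡j)
    ... | ≡.refl with FinP.toℕ-injective {i = j₀′} {j = j′} (≡.trans j₀⋯j₀′ (≡.sym j⋯j′))
    ... | ≡.refl = i<i′

  -- position t of a subset of [k-1] stands for the gap between t and t+1 in [0, k)
  strictSet : (Fin k → Fin m) → Subset (k ∸ 1)
  strictSet i = Vec.tabulate (λ t → does (strictAt? i (suc (toℕ t))))

  ∈-strictSet⇔ : (i : Fin k → Fin m) (t : Fin (k ∸ 1)) → t ∈ strictSet i ⇔ StrictAt i (suc (toℕ t))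
  ∈-strictSet⇔ i t = mk⇔
    (λ t∈ → does≡true⇒ (strictAt? i _) (≡.trans (≡.sym (VecP.lookup∘tabulate _ t)) (VecP.[]=⇒lookup t∈)))
    (λ strict → VecP.lookup⇒[]= t (strictSet i) (≡.trans (VecP.lookup∘tabulate _ t) (dec-true (strictAt? i _) strict)))

  isFSeq⇔ : (S : Subset (k ∸ 1)) (i : Fin k → Fin m) → IsFSeq (comp S) i ⇔ (WeaklyIncreasing i × S ⊆ strictSet i)
  isFSeq⇔ S i = mk⇔ to from
    where
    to : IsFSeq (comp S) i → WeaklyIncreasing i × S ⊆ strictSet i
    to fseq = (λ j j′ j⋯j′ → proj₁ (fseq j j′ j⋯j′))
            , λ {t} t∈S → Equivalence.from (∈-strictSet⇔ i t)
                            λ j j′ j⋯j′ j≡t → proj₂ (fseq j j′ j⋯j′) (t , t∈S , ≡.sym j≡t)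
    from : WeaklyIncreasing i × S ⊆ strictSet i → IsFSeq (comp S) i
    from (weak , S⊆) j j′ j⋯j′ =
      weak j j′ j⋯j′ , λ (t , t∈S , t≡j) → Equivalence.to (∈-strictSet⇔ i t) (S⊆ t∈S) j j′ j⋯j′ (≡.sym t≡j)

gaps⇔ : {k : ℕ} (P : ℕ → Set) →
        (∀ (t : Fin (k ∸ 1)) → P (suc (toℕ t))) ⇔ (∀ (j j′ : Fin k) → Consecutive j j′ → P (suc (toℕ j)))
gaps⇔ {zero}  P = mk⇔ (λ _ ()) (λ _ ())
gaps⇔ {suc k} P = mk⇔ to from
  where
  to : (∀ (t : Fin k) → P (suc (toℕ t))) → ∀ (j j′ : Fin (suc k)) → Consecutive j j′ → P (suc (toℕ j))
  to all-t j j′ j⋯j′ = subst (λ x → P (suc x)) (FinP.toℕ-fromℕ< j<k) (all-t (Fin.fromℕ< j<k))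
    where
    j<k : toℕ j < k
    j<k = ℕP.≤-pred (subst (_< suc k) j⋯j′ (FinP.toℕ<n j′))
  from : (∀ (j j′ : Fin (suc k)) → Consecutive j j′ → P (suc (toℕ j))) → ∀ (t : Fin k) → P (suc (toℕ t))
  from all-gaps t = subst (λ x → P (suc x)) (FinP.toℕ-inject₁ t)
                      (all-gaps (Fin.inject₁ t) (Fin.suc t) (≡.cong suc (≡.sym (FinP.toℕ-inject₁ t))))

module _ {a b : Level} {A : Set a} {_⊏_ : Rel A b} (⊏-trans : Transitive _⊏_) (_⊏?_ : Decidable₂ _⊏_) where

  consecutive⇒isPartition : {ℓ m : ℕ} (γ : Fin ℓ → A) (f : Fin ℓ → Fin m) →
    (∀ k k′ → Consecutive k k′ → f k Fin.≤ f k′ × (f k ≡ f k′ → γ k ⊏ γ k′)) → IsPartition _⊏_ _⊏?_ γ f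
  consecutive⇒isPartition {ℓ} γ f steps p q p<q =
    monotone p q (ℕP.<⇒≤ p<q)
    , chain (toℕ q ∸ suc (toℕ p)) p q (≡.sym (≡.trans (ℕP.+-suc _ _) (ℕP.m+[n∸m]≡n p<q)))
    where
    monotone : (p q : Fin ℓ) → toℕ p ≤ toℕ q → f p Fin.≤ f q
    monotone = weaklyIncreasing⇒monotone (λ k k′ k⋯k′ → proj₁ (steps k k′ k⋯k′))
    chain : ∀ d p q → toℕ q ≡ toℕ p ℕ.+ suc d → f p ≡ f q → γ p ⊏ γ q
    chain zero    p q q≡p+1 fp≡fq = proj₂ (steps p q (≡.trans q≡p+1 (ℕP.+-comm (toℕ p) 1))) fp≡fq
    chain (suc d) p q q≡p+d fp≡fq = ⊏-trans (proj₂ (steps p r r≡p+1) fp≡fr) (chain d r q q≡r+d fr≡fq)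
      where
      p+1<q : suc (toℕ p) < toℕ q
      p+1<q = subst (suc (toℕ p) <_) (≡.sym (≡.trans q≡p+d (ℕP.+-suc (toℕ p) (suc d))))
                (s≤s (ℕP.m<m+n (toℕ p) (s≤s z≤n)))
      r : Fin ℓ
      r = Fin.fromℕ< (ℕP.<-trans p+1<q (FinP.toℕ<n q))
      r≡p+1 : toℕ r ≡ suc (toℕ p)
      r≡p+1 = FinP.toℕ-fromℕ< _
      fp≡fr : f p ≡ f r
      fp≡fr = FinP.≤-antisym (monotone p r (ℕP.≤-trans (ℕP.n≤1+n _) (ℕP.≤-reflexive (≡.sym r≡p+1))))
                (subst (f r Fin.≤_) (≡.sym fp≡fq) (monotone r q (subst (_≤ toℕ q) (≡.sym r≡p+1) (ℕP.<⇒≤ p+1<q))))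
      fr≡fq : f r ≡ f q
      fr≡fq = ≡.trans (≡.sym fp≡fr) fp≡fq
      q≡r+d : toℕ q ≡ toℕ r ℕ.+ suc d
      q≡r+d = ≡.trans q≡p+d (≡.trans (ℕP.+-suc (toℕ p) (suc d)) (≡.cong (ℕ._+ suc d) (≡.sym r≡p+1)))

module LabelledChain {c ℓ₁ ℓ₂ : Level} (C : StrictTotalOrder c ℓ₁ ℓ₂) {ℓ : ℕ}
  (γ : Fin ℓ → StrictTotalOrder.Carrier C)
  (γ-injective : ∀ p q → StrictTotalOrder._≈_ C (γ p) (γ q) → p ≡ q)
  (w : Fin ℓ → ℕ) (w>0 : ∀ u → 1 ≤ w u) where

  open StrictTotalOrder C using (compare)
    renaming (Carrier to X; _<_ to _⊏_; _<?_ to _⊏?_; trans to ⊏-trans; asym to ⊏-asym)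
  open Blocks w w>0

  ⊏-irrefl : ∀ {x} → ¬ (x ⊏ x)
  ⊏-irrefl x⊏x = ⊏-asym x⊏x x⊏x

  module _ {r : Level} (R : Rel X r) (R? : Decidable₂ R) where

    noDesAt : {x : ℕ} → (∀ k → psum w k ≢ x) → ¬ IsDesAt R R? γ w x
    noDesAt no-psum (k , _ , _ , p≡x , _) = no-psum k p≡x

    desAt⇔ : (b b′ : Fin ℓ) {x : ℕ} → Consecutive b b′ → psum w b ≡ x →
             IsDesAt R R? γ w x ⇔ R (γ b′) (γ b)
    desAt⇔ b b′ b⋯b′ p≡x = mk⇔ to (λ r → b , b′ , b⋯b′ , p≡x , r)
      where
      to : IsDesAt R R? γ w _ → R (γ b′) (γ b)
      to (k , k′ , k⋯k′ , p≡x′ , r) with psum-injective k b (≡.trans p≡x′ (≡.sym p≡x))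
      ... | ≡.refl with FinP.toℕ-injective {i = k′} {j = b′} (≡.trans k⋯k′ (≡.sym b⋯b′))
      ... | ≡.refl = r

  -- the descents of the dual labelling γ* are the ascents of γ
  Asc? : (x : ℕ) → Dec (IsDesAt (flip _⊏_) (flip _⊏?_) γ w x)
  Asc? = IsDesAt? (flip _⊏_) (flip _⊏?_) γ w

  Des? : (x : ℕ) → Dec (IsDesAt _⊏_ _⊏?_ γ w x)
  Des? = IsDesAt? _⊏_ _⊏?_ γ w

  nonAscents descents : Subset (n ∸ 1)
  nonAscents = ∁ (set (δγ* C γ w))
  descents   = set (δγ C γ w)

  module _ {m : ℕ} where

    GapOK : (Fin n → Fin m) → Fin n → Fin n → Set ℓ₂
    GapOK i j j′ = (blockOf j ≡ blockOf j′ → i j ≡ i j′)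
                 × (γ (blockOf j′) ⊏ γ (blockOf j) → i j Fin.< i j′)

    -- entry x - 1 of the equation  nonAscents ∩ strictSet i ≡ descents
    GapEquation : (Fin n → Fin m) → ℕ → Set
    GapEquation i x = (not (does (Asc? x)) ∧ does (strictAt? i x)) ≡ does (Des? x)

    module _ {i : Fin n → Fin m} (weak : WeaklyIncreasing i) {j j′ : Fin n} (j⋯j′ : Consecutive j j′) where

      private
        x = suc (toℕ j)

        strict⇔ : StrictAt i x ⇔ (i j Fin.< i j′)
        strict⇔ = strictAt⇔ i j j′ j⋯j′

        no-psum-at-x : (∀ k → psum w k ≢ toℕ j′) → ∀ k → psum w k ≢ x
        no-psum-at-x no-psum k p≡x = no-psum k (≡.trans p≡x (≡.sym j⋯j′))

        desAt-x⇔ : ∀ {r} (R : Rel X r) (R? : Decidable₂ R) → Consecutive (blockOf j) (blockOf j′) →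
                   psum w (blockOf j) ≡ toℕ j′ → IsDesAt R R? γ w x ⇔ R (γ (blockOf j′)) (γ (blockOf j))
        desAt-x⇔ R R? b⋯b′ p≡j′ = desAt⇔ R R? _ _ b⋯b′ (≡.trans p≡j′ j⋯j′)

      gapEquation⇔inside : blockOf j ≡ blockOf j′ → (∀ k → psum w k ≢ toℕ j′) →
                           GapEquation i x ⇔ GapOK i j j′
      gapEquation⇔inside b≡b′ no-psum
        rewrite dec-false (Asc? x) (noDesAt (flip _⊏_) (flip _⊏?_) (no-psum-at-x no-psum))
              | dec-false (Des? x) (noDesAt _⊏_ _⊏?_ (no-psum-at-x no-psum))
        = mk⇔ to from
        where
        to : does (strictAt? i x) ≡ false → GapOK i j j′
        to not-strict =
          (λ _ → FinP.toℕ-injective (ℕP.≤∧≮⇒≡ (weak j j′ j⋯j′)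
                   (does≡false⇒ (strictAt? i x) not-strict ∘ Equivalence.from strict⇔)))
          , λ descent → ⊥-elim (⊏-irrefl (subst (λ b → γ b ⊏ γ (blockOf j)) (≡.sym b≡b′) descent))
        from : GapOK i j j′ → does (strictAt? i x) ≡ false
        from (same , _) = dec-false (strictAt? i x) (FinP.<-irrefl (same b≡b′) ∘ Equivalence.to strict⇔)

      gapEquation⇔across : Consecutive (blockOf j) (blockOf j′) → psum w (blockOf j) ≡ toℕ j′ →
                           GapEquation i x ⇔ GapOK i j j′
      gapEquation⇔across b⋯b′ p≡j′ with compare (γ (blockOf j)) (γ (blockOf j′))
      ... | tri< ascent _ _
        rewrite dec-true (Asc? x) (Equivalence.from (desAt-x⇔ (flip _⊏_) (flip _⊏?_) b⋯b′ p≡j′) ascent)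
              | dec-false (Des? x) (⊏-asym ascent ∘ Equivalence.to (desAt-x⇔ _⊏_ _⊏?_ b⋯b′ p≡j′))
        = mk⇔ (λ _ → ⊥-elim ∘ consecutive-distinct b⋯b′ , ⊥-elim ∘ ⊏-asym ascent) (λ _ → ≡.refl)
      ... | tri> _ _ descent
        rewrite dec-false (Asc? x) (⊏-asym descent ∘ Equivalence.to (desAt-x⇔ (flip _⊏_) (flip _⊏?_) b⋯b′ p≡j′))
              | dec-true (Des? x) (Equivalence.from (desAt-x⇔ _⊏_ _⊏?_ b⋯b′ p≡j′) descent)
        = mk⇔ (λ strict → ⊥-elim ∘ consecutive-distinct b⋯b′
                        , λ _ → Equivalence.to strict⇔ (does≡true⇒ (strictAt? i x) strict))
              (λ (_ , descent⇒<) → dec-true (strictAt? i x) (Equivalence.from strict⇔ (descent⇒< descent)))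
      ... | tri≈ _ γ≈γ′ _ = ⊥-elim (consecutive-distinct b⋯b′ (γ-injective _ _ γ≈γ′))

    gapEquation⇔gapOK : {i : Fin n → Fin m} → WeaklyIncreasing i → (j j′ : Fin n) → Consecutive j j′ →
                        GapEquation i (suc (toℕ j)) ⇔ GapOK i j j′
    gapEquation⇔gapOK weak j j′ j⋯j′ with gap j j′ j⋯j′
    ... | inside b≡b′ no-psum = gapEquation⇔inside weak j⋯j′ b≡b′ no-psum
    ... | across b⋯b′ p≡j′    = gapEquation⇔across weak j⋯j′ b⋯b′ p≡j′

    strictSet-equation⇔ : {i : Fin n → Fin m} → WeaklyIncreasing i →
      nonAscents ∩ strictSet i ≡ descents ⇔ (∀ j j′ → Consecutive j j′ → GapOK i j j′)
    strictSet-equation⇔ {i} weak =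
      ⇔-trans (⇔-trans (⇔-trans (≡⇔lookup _ _) entries) (gaps⇔ (GapEquation i)))
        (mk⇔ (λ eqs j j′ j⋯j′ → Equivalence.to (gapEquation⇔gapOK weak j j′ j⋯j′) (eqs j j′ j⋯j′))
             (λ oks j j′ j⋯j′ → Equivalence.from (gapEquation⇔gapOK weak j j′ j⋯j′) (oks j j′ j⋯j′)))
      where
      asc str des : Fin (n ∸ 1) → Bool
      asc t = does (Asc? (suc (toℕ t)))
      str t = does (strictAt? i (suc (toℕ t)))
      des t = does (Des? (suc (toℕ t)))
      lookup-lhs : ∀ t → Vec.lookup (nonAscents ∩ strictSet i) t ≡ not (asc t) ∧ str t
      lookup-lhs t = ≡.trans (VecP.lookup-zipWith _∧_ t nonAscents (strictSet i))
        (≡.cong₂ _∧_ (≡.trans (VecP.lookup-map t not (set (δγ* C γ w))) (≡.cong not (VecP.lookup∘tabulate asc t)))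
                     (VecP.lookup∘tabulate str t))
      entries : (∀ t → Vec.lookup (nonAscents ∩ strictSet i) t ≡ Vec.lookup descents t)
                ⇔ (∀ t → GapEquation i (suc (toℕ t)))
      entries = mk⇔ (λ eqs t → ≡.trans (≡.sym (lookup-lhs t)) (≡.trans (eqs t) (VecP.lookup∘tabulate des t)))
                    (λ eqs t → ≡.trans (lookup-lhs t) (≡.trans (eqs t) (≡.sym (VecP.lookup∘tabulate des t))))

    module _ {f : Fin ℓ → Fin m} (partition : IsPartition _⊏_ _⊏?_ γ f) where

      isPartition⇒weaklyIncreasing : WeaklyIncreasing (f ∘ blockOf)
      isPartition⇒weaklyIncreasing j j′ j⋯j′ with gap j j′ j⋯j′
      ... | inside b≡b′ _ = ℕP.≤-reflexive (≡.cong (toℕ ∘ f) b≡b′)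
      ... | across b⋯b′ _ = proj₁ (partition _ _ (ℕP.≤-reflexive (≡.sym b⋯b′)))

      isPartition⇒gapOK : ∀ j j′ → Consecutive j j′ → GapOK (f ∘ blockOf) j j′
      isPartition⇒gapOK j j′ j⋯j′ = ≡.cong f , descent⇒<
        where
        descent⇒< : γ (blockOf j′) ⊏ γ (blockOf j) → f (blockOf j) Fin.< f (blockOf j′)
        descent⇒< descent with gap j j′ j⋯j′
        ... | inside b≡b′ _ = ⊥-elim (⊏-irrefl (subst (λ b → γ (blockOf j′) ⊏ γ b) b≡b′ descent))
        ... | across b⋯b′ _ =
          ℕP.≤∧≢⇒< (proj₁ step) (⊏-asym descent ∘ proj₂ step ∘ FinP.toℕ-injective)
          where step = partition _ _ (ℕP.≤-reflexive (≡.sym b⋯b′))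

    module _ {i : Fin n → Fin m} (weak : WeaklyIncreasing i)
             (gapOK : ∀ j j′ → Consecutive j j′ → GapOK i j j′) where

      constant-on-blocks : (j : Fin n) → i (startPos (blockOf j)) ≡ i j
      constant-on-blocks j = go (toℕ j ∸ start u) j (≡.sym (ℕP.m+[n∸m]≡n (proj₁ (inBlock-blockOf j)))) ≡.refl
        where
        u = blockOf j
        go : ∀ d j → toℕ j ≡ start u ℕ.+ d → blockOf j ≡ u → i (startPos u) ≡ i j
        go zero    j j≡s   _    = ≡.cong i (FinP.toℕ-injective
                                    (≡.trans (toℕ-startPos u) (≡.sym (≡.trans j≡s (ℕP.+-identityʳ _)))))
        go (suc d) j j≡s+d b≡u =
          ≡.trans (go d j₀ (FinP.toℕ-fromℕ< s+d<n) b₀≡u) (proj₁ (gapOK j₀ j j₀⋯j) (≡.trans b₀≡u (≡.sym b≡u)))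
          where
          s+d<j : start u ℕ.+ d < toℕ j
          s+d<j = ℕP.≤-reflexive (≡.sym (≡.trans j≡s+d (ℕP.+-suc _ d)))
          s+d<n : start u ℕ.+ d < n
          s+d<n = ℕP.<-trans s+d<j (FinP.toℕ<n j)
          j₀ : Fin n
          j₀ = Fin.fromℕ< s+d<n
          j₀⋯j : Consecutive j₀ j
          j₀⋯j = ≡.trans j≡s+d (≡.trans (ℕP.+-suc _ d) (≡.cong suc (≡.sym (FinP.toℕ-fromℕ< s+d<n))))
          b₀≡u : blockOf j₀ ≡ u
          b₀≡u = blockOf-unique j₀ u
            ( subst (start u ≤_) (≡.sym (FinP.toℕ-fromℕ< s+d<n)) (ℕP.m≤m+n _ d)
            , subst (_< psum w u) (≡.sym (FinP.toℕ-fromℕ< s+d<n))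
                (ℕP.<-trans s+d<j (subst (λ v → toℕ j < psum w v) b≡u (proj₂ (inBlock-blockOf j)))))

      isPartition-startPos : IsPartition _⊏_ _⊏?_ γ (i ∘ startPos)
      isPartition-startPos = consecutive⇒isPartition ⊏-trans _⊏?_ γ (i ∘ startPos) λ k k′ k⋯k′ →
        weaklyIncreasing⇒monotone weak (startPos k) (startPos k′) (start≤start k k′ k⋯k′) , equal⇒ascent k k′ k⋯k′
        where
        start≤start : ∀ k k′ → Consecutive k k′ → toℕ (startPos k) ≤ toℕ (startPos k′)
        start≤start k k′ k⋯k′ = subst₂ _≤_ (≡.sym (toℕ-startPos k)) (≡.sym (toℕ-startPos k′))
          (ℕP.<⇒≤ (subst (start k <_) (≡.sym (start-step k k′ k⋯k′)) (start<psum k)))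
        -- a descent from block k to block k′ forces a strict increase across the gap between them
        equal⇒ascent : ∀ k k′ → Consecutive k k′ → i (startPos k) ≡ i (startPos k′) → γ k ⊏ γ k′
        equal⇒ascent k k′ k⋯k′ i≡i′ with compare (γ k) (γ k′)
        ... | tri< ascent _ _ = ascent
        ... | tri≈ _ γ≈γ′ _   = ⊥-elim (consecutive-distinct k⋯k′ (γ-injective _ _ γ≈γ′))
        ... | tri> _ _ descent = ⊥-elim (FinP.<-irrefl i≡i′ (subst (Fin._< i (startPos k′)) i-last≡ strict-across))
          where
          strict-across : i (lastPos k) Fin.< i (startPos k′)
          strict-across = proj₂ (gapOK (lastPos k) (startPos k′) (lastPos⋯startPos k k′ k⋯k′))
            (subst₂ (λ b b′ → γ b′ ⊏ γ b) (≡.sym (blockOf-lastPos k)) (≡.sym (blockOf-startPos k′)) descent)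
          i-last≡ : i (lastPos k) ≡ i (startPos k)
          i-last≡ = ≡.trans (≡.sym (constant-on-blocks (lastPos k))) (≡.cong (i ∘ startPos) (blockOf-lastPos k))

    module _ (a : Vec ℕ m) where

      WeightedPartition : (Fin ℓ → Fin m) → Set ℓ₂
      WeightedPartition f = IsPartition _⊏_ _⊏?_ γ f × expo w f ≡ a

      weightedPartition? : (f : Fin ℓ → Fin m) → Dec (WeightedPartition f)
      weightedPartition? f = IsPartition? _⊏_ _⊏?_ γ f ×-dec VecP.≡-dec ℕ._≟_ (expo w f) a

      Admissible : (Fin n → Fin m) → Set
      Admissible i = WeaklyIncreasing i × (nonAscents ∩ strictSet i ≡ descents × expo (λ _ → 1) i ≡ a)

      admissible? : (i : Fin n → Fin m) → Dec (Admissible i)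
      admissible? i = weaklyIncreasing? i
                ×-dec ((nonAscents ∩ strictSet i) ≟ₛ descents ×-dec VecP.≡-dec ℕ._≟_ (expo (λ _ → 1) i) a)

      weightedPartition-resp : {f g : Fin ℓ → Fin m} → (∀ u → f u ≡ g u) →
                               WeightedPartition f → WeightedPartition g
      weightedPartition-resp f≗g (partition , expo≡a) =
        (λ p q p<q → subst₂ Fin._≤_ (f≗g p) (f≗g q) (proj₁ (partition p q p<q))
                   , λ gp≡gq → proj₂ (partition p q p<q) (≡.trans (f≗g p) (≡.trans gp≡gq (≡.sym (f≗g q)))))
        , ≡.trans (≡.sym (expo-cong w f≗g)) expo≡a

      admissible-resp : {i i′ : Fin n → Fin m} → (∀ x → i x ≡ i′ x) → Admissible i → Admissible i′
      admissible-resp {i} {i′} i≗i′ (weak , equation , expo≡a) =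
        (λ j j′ j⋯j′ → subst₂ Fin._≤_ (i≗i′ j) (i≗i′ j′) (weak j j′ j⋯j′))
        , ≡.trans (≡.cong (nonAscents ∩_) (≡.sym strictSet≡)) equation
        , ≡.trans (≡.sym (expo-cong (λ _ → 1) i≗i′)) expo≡a
        where
        strictAt-resp : ∀ {i i′ : Fin n → Fin m} → (∀ x → i x ≡ i′ x) → ∀ x → StrictAt i x → StrictAt i′ x
        strictAt-resp i≗i′ x strict j j′ j⋯j′ j≡x = subst₂ Fin._<_ (i≗i′ j) (i≗i′ j′) (strict j j′ j⋯j′ j≡x)
        strictSet≡ : strictSet i ≡ strictSet i′
        strictSet≡ = VecP.tabulate-cong λ t → does-⇔
          (mk⇔ (strictAt-resp i≗i′ _) (strictAt-resp (λ x → ≡.sym (i≗i′ x)) _)) (strictAt? i _) (strictAt? i′ _)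

      admissible⇒gapOK : {i : Fin n → Fin m} → Admissible i → ∀ j j′ → Consecutive j j′ → GapOK i j j′
      admissible⇒gapOK (weak , equation , _) = Equivalence.to (strictSet-equation⇔ weak) equation

      admissible⇒constant-on-blocks : (i : Fin n → Fin m) → Admissible i → ∀ j → i (startPos (blockOf j)) ≡ i j
      admissible⇒constant-on-blocks i adm = constant-on-blocks (proj₁ adm) (admissible⇒gapOK adm)

      weightedPartition⇒admissible : (f : Fin ℓ → Fin m) → WeightedPartition f → Admissible (f ∘ blockOf)
      weightedPartition⇒admissible f (partition , expo≡a) =
        isPartition⇒weaklyIncreasing partition
        , Equivalence.from (strictSet-equation⇔ (isPartition⇒weaklyIncreasing partition)) (isPartition⇒gapOK partition)
        , ≡.trans (expo-blockOf f) expo≡a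

      admissible⇒weightedPartition : (i : Fin n → Fin m) → Admissible i → WeightedPartition (i ∘ startPos)
      admissible⇒weightedPartition i adm@(weak , _ , expo≡a) =
        isPartition-startPos weak (admissible⇒gapOK adm)
        , ≡.trans (≡.sym (expo-blockOf (i ∘ startPos)))
                  (≡.trans (expo-cong (λ _ → 1) (admissible⇒constant-on-blocks i adm)) expo≡a)

      K≡∑admissible : Kchain C γ w m a ≡ ∑ (allFuns n m) (λ i → 𝟙 (does (admissible? i)))
      K≡∑admissible = ≡.trans (count≡∑ weightedPartition? (allFuns ℓ m))
        (∑-reindex weightedPartition? admissible? weightedPartition-resp admissible-resp
                   blockOf startPos blockOf-startPos
                   weightedPartition⇒admissible admissible⇒weightedPartition admissible⇒constant-on-blocks)

      open import Data.Integer using (_+_; _*_)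

      private
        E : (Fin n → Fin m) → Bool
        E i = does (VecP.≡-dec ℕ._≟_ (expo (λ _ → 1) i) a)

        -- the summand of RHS at β = comp S, with F β expanded as a sum over sequences i
        term : Subset (n ∸ 1) → (Fin n → Fin m) → ℤ
        term S i = 𝟙 (does (S ⊆? nonAscents) ∧ does (descents ⊆? S))
                   * (sign (len n (comp S) ∸ len n (comp descents)) * 𝟙 (does (IsFSeq? (comp S) i) ∧ E i))

        interval-summand : Subset (n ∸ 1) → (Fin n → Fin m) → ℤ
        interval-summand S i = 𝟙 (does (descents ⊆? S)) * 𝟙 (does (S ⊆? nonAscents ∩ strictSet i)) * sign ∣ S ∣

        term≡ : ∀ S i → term S i ≡ (𝟙 (does (weaklyIncreasing? i)) * 𝟙 (E i) * sign ∣ descents ∣)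
                                   * interval-summand S i
        term≡ S i = begin
          term S i
            ≡⟨ ≡.cong₂ (λ x y → x * (sΔ * y)) (𝟙-∧ (does (S ⊆? nonAscents)) _) 𝟙-fseq ⟩
          (𝟙a * 𝟙l) * (sΔ * ((𝟙wk * 𝟙d) * 𝟙e))
            ≡⟨ regroup₁ 𝟙a 𝟙l sΔ 𝟙wk 𝟙d 𝟙e ⟩
          (𝟙wk * 𝟙e) * ((𝟙l * sΔ) * (𝟙a * 𝟙d))
            ≡⟨ ≡.cong₂ (λ x y → (𝟙wk * 𝟙e) * (x * y)) (𝟙⊆-sign n S descents) (𝟙⊆∩ S nonAscents (strictSet i)) ⟩
          (𝟙wk * 𝟙e) * ((𝟙l * (sign ∣ S ∣ * sign ∣ descents ∣)) * 𝟙 (does (S ⊆? nonAscents ∩ strictSet i)))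
            ≡⟨ regroup₂ 𝟙wk 𝟙e 𝟙l (sign ∣ S ∣) (sign ∣ descents ∣) _ ⟩
          (𝟙wk * 𝟙e * sign ∣ descents ∣) * interval-summand S i ∎
          where
          open ≡.≡-Reasoning
          𝟙a = 𝟙 (does (S ⊆? nonAscents))
          𝟙l = 𝟙 (does (descents ⊆? S))
          𝟙d = 𝟙 (does (S ⊆? strictSet i))
          𝟙wk = 𝟙 (does (weaklyIncreasing? i))
          𝟙e = 𝟙 (E i)
          sΔ = sign (len n (comp S) ∸ len n (comp descents))
          𝟙-fseq : 𝟙 (does (IsFSeq? (comp S) i) ∧ E i) ≡ (𝟙wk * 𝟙d) * 𝟙e
          𝟙-fseq = ≡.trans
            (≡.cong (λ b → 𝟙 (b ∧ E i)) (does-⇔ (isFSeq⇔ S i) (IsFSeq? (comp S) i) (weaklyIncreasing? i ×-dec (S ⊆? strictSet i))))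
            (≡.trans (𝟙-∧ _ (E i)) (≡.cong (_* 𝟙e) (𝟙-∧ (does (weaklyIncreasing? i)) _)))
          regroup₁ : ∀ a l s wk d e → (a * l) * (s * ((wk * d) * e)) ≡ (wk * e) * ((l * s) * (a * d))
          regroup₁ = solve-∀
          regroup₂ : ∀ wk e l sS sL ad → (wk * e) * ((l * (sS * sL)) * ad) ≡ (wk * e * sL) * (l * ad * sS)
          regroup₂ = solve-∀

        ∑term≡𝟙admissible : ∀ i → ∑ (allSubsets (n ∸ 1)) (λ S → term S i) ≡ 𝟙 (does (admissible? i))
        ∑term≡𝟙admissible i = begin
          ∑ (allSubsets (n ∸ 1)) (λ S → term S i)
            ≡⟨ ∑-cong (allSubsets (n ∸ 1)) (λ S → term≡ S i) ⟩
          ∑ (allSubsets (n ∸ 1)) (λ S → κ * interval-summand S i)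
            ≡⟨ ∑-distribˡ (allSubsets (n ∸ 1)) κ _ ⟨
          κ * ∑ (allSubsets (n ∸ 1)) (λ S → interval-summand S i)
            ≡⟨ ≡.cong (κ *_) (∑-interval (n ∸ 1) descents (nonAscents ∩ strictSet i)) ⟩
          κ * (𝟙eq * sign ∣ descents ∣)
            ≡⟨ regroup 𝟙wk 𝟙e 𝟙eq (sign ∣ descents ∣) ⟩
          𝟙wk * (𝟙eq * 𝟙e) * (sign ∣ descents ∣ * sign ∣ descents ∣)
            ≡⟨ ≡.cong (𝟙wk * (𝟙eq * 𝟙e) *_) (sign²≡1 ∣ descents ∣) ⟩
          𝟙wk * (𝟙eq * 𝟙e) * + 1
            ≡⟨ ℤP.*-identityʳ _ ⟩
          𝟙wk * (𝟙eq * 𝟙e)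
            ≡⟨ ≡.trans (≡.cong (𝟙wk *_) (≡.sym (𝟙-∧ _ (E i)))) (≡.sym (𝟙-∧ (does (weaklyIncreasing? i)) _)) ⟩
          𝟙 (does (admissible? i)) ∎
          where
          open ≡.≡-Reasoning
          𝟙wk = 𝟙 (does (weaklyIncreasing? i))
          𝟙e = 𝟙 (E i)
          𝟙eq = 𝟙 (does ((nonAscents ∩ strictSet i) ≟ₛ descents))
          κ = 𝟙wk * 𝟙e * sign ∣ descents ∣
          regroup : ∀ wk e q s → (wk * e * s) * (q * s) ≡ wk * (q * e) * (s * s)
          regroup = solve-∀

      RHS≡∑admissible : RHS C γ w m a ≡ ∑ (allFuns n m) (λ i → 𝟙 (does (admissible? i)))
      RHS≡∑admissible = begin
        RHS C γ w m a
          ≡⟨ ∑-filter inInterval? (allComps n) coefficient ⟩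
        ∑ (allComps n) (λ β → 𝟙 (does (inInterval? β)) * coefficient β)
          ≡⟨ ∑-map comp (allSubsets (n ∸ 1)) (λ β → 𝟙 (does (inInterval? β)) * coefficient β) ⟩
        ∑ (allSubsets (n ∸ 1)) (λ S → 𝟙 (does (inInterval? (comp S))) * coefficient (comp S))
          ≡⟨ ∑-cong (allSubsets (n ∸ 1)) expand-F ⟩
        ∑ (allSubsets (n ∸ 1)) (λ S → ∑ (allFuns n m) (term S))
          ≡⟨ ∑-comm (allSubsets (n ∸ 1)) (allFuns n m) term ⟩
        ∑ (allFuns n m) (λ i → ∑ (allSubsets (n ∸ 1)) (λ S → term S i))
          ≡⟨ ∑-cong (allFuns n m) ∑term≡𝟙admissible ⟩
        ∑ (allFuns n m) (λ i → 𝟙 (does (admissible? i))) ∎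
        where
        open ≡.≡-Reasoning
        inInterval? : (β : Comp n) → Dec (((δγ* C γ w ᶜ) ≼ β) × (β ≼ δγ C γ w))
        inInterval? β = ((δγ* C γ w ᶜ) ≼? β) ×-dec (β ≼? δγ C γ w)
        coefficient : Comp n → ℤ
        coefficient β = sign (len n β ∸ len n (δγ C γ w)) * F n β m a
        expand-F : ∀ S → 𝟙 (does (inInterval? (comp S))) * coefficient (comp S) ≡ ∑ (allFuns n m) (term S)
        expand-F S = begin
          𝟙I * (sΔ * F n (comp S) m a)
            ≡⟨ ≡.cong (λ x → 𝟙I * (sΔ * x)) (count≡∑ (λ i → IsFSeq? (comp S) i ×-dec E? i) (allFuns n m)) ⟩
          𝟙I * (sΔ * ∑ (allFuns n m) (λ i → 𝟙 (does (IsFSeq? (comp S) i) ∧ E i)))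
            ≡⟨ ≡.cong (𝟙I *_) (∑-distribˡ (allFuns n m) sΔ _) ⟩
          𝟙I * ∑ (allFuns n m) (λ i → sΔ * 𝟙 (does (IsFSeq? (comp S) i) ∧ E i))
            ≡⟨ ∑-distribˡ (allFuns n m) 𝟙I _ ⟩
          ∑ (allFuns n m) (term S) ∎
          where
          E? = λ i → VecP.≡-dec ℕ._≟_ (expo (λ _ → 1) i) a
          𝟙I = 𝟙 (does (inInterval? (comp S)))
          sΔ = sign (len n (comp S) ∸ len n (comp descents))

lemma3p6 : {c ℓ₁ ℓ₂ : Level} (C : StrictTotalOrder c ℓ₁ ℓ₂) (ℓ : ℕ)
    (γ : Fin ℓ → StrictTotalOrder.Carrier C)
    → (∀ p q → StrictTotalOrder._≈_ C (γ p) (γ q) → p ≡ q)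
    → (w : Fin ℓ → ℕ) → (∀ u → 1 ≤ w u)
    → (m : ℕ) (a : Vec ℕ m)
    → Kchain C γ w m a ≡ RHS C γ w m a
lemma3p6 C ℓ γ γ-injective w w>0 m a =
  ≡.trans (K≡∑admissible a) (≡.sym (RHS≡∑admissible a))
  where open LabelledChain C γ γ-injective w w>0
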